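{- Let $\kappa_1,\kappa_2,\kappa_3$ be non-negative integers with $\kappa_1+\kappa_2+\kappa_3$ even and $\kappa_i^*:=\frac{\kappa_1+\kappa_2+\kappa_3}{2}-\kappa_i\ge0$ for $i=1,2,3$. Let $$\mathbf P_{\underline\kappa}=(X_1Y_2-X_2Y_1)^{\kappa_3^*}(X_3Y_1-X_1Y_3)^{\kappa_2^*}(X_3Y_2-X_2Y_3)^{\kappa_1^*}\in L_{\kappa_1}\otimes L_{\kappa_2}\otimes L_{\kappa_3}.$$ Then $$\langle\mathbf P_{\underline\kappa},\mathbf P_{\underline\kappa}\rangle_{\underline\kappa}=\frac{\Gamma(\frac{\kappa_1+\kappa_2+\kappa_3}{2}+2)\,\Gamma(\kappa_1^*+1)\Gamma(\kappa_2^*+1)\Gamma(\kappa_3^*+1)}{\Gamma(\kappa_1+1)\Gamma(\kappa_2+1)\Gamma(\kappa_3+1)}.$$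
   Context: $L_\kappa$ is the space of homogeneous polynomials of degree $\kappa$ in two variables $X,Y$ over $\mathbb C$, with bilinear pairing $\langle X^iY^{\kappa-i},X^jY^{\kappa-j}\rangle_\kappa=(-1)^i\binom{\kappa}{i}^{ -1}$ if $i+j=\kappa$ and $0$ otherwise. $L_{\kappa_1}\otimes L_{\kappa_2}\otimes L_{\kappa_3}$ is identified with polynomials in $(X_1,Y_1,X_2,Y_2,X_3,Y_3)$ homogeneous of degree $\kappa_i$ in $(X_i,Y_i)$, and $\langle\cdot,\cdot\rangle_{\underline\kappa}=\langle\cdot,\cdot\rangle_{\kappa_1}\otimes\langle\cdot,\cdot\rangle_{\kappa_2}\otimes\langle\cdot,\cdot\rangle_{\kappa_3}$. -}

module Defs where

open import Data.Nat as ℕ using (ℕ; zero; suc; _∸_; _!; _≟_)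
open import Data.Nat.Properties using (_!≢0; _!*_!≢0)
open import Data.Integer using (+_)
open import Data.Rational using (ℚ; 0ℚ; 1ℚ; _/_; -_; _+_; _*_)
open import Data.List using (List; []; _∷_; map; concatMap; _++_; foldr)
open import Data.Vec using (Vec; []; _∷_; zipWith; replicate; lookup)
open import Data.Fin using (Fin)
open import Data.Product using (_×_; _,_)
open import Relation.Nullary using (yes; no)

-- Polynomials in the six variables X₁,Y₁,X₂,Y₂,X₃,Y₃ with rational
-- coefficients, represented as finite formal sums of monomials
-- c · X₁^e₀ Y₁^e₁ X₂^e₂ Y₂^e₃ X₃^e₄ Y₃^e₅  (exponent vector e : Vec ℕ 6).
-- (Not necessarily in normal form; everything below is defined
-- bilinearly, so the representation does not matter.)

Exps : Set
Exps = Vec ℕ 6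

Poly : Set
Poly = List (ℚ × Exps)

one : Poly
one = (1ℚ , replicate 6 0) ∷ []

X₁ Y₁ X₂ Y₂ X₃ Y₃ : Poly
X₁ = (1ℚ , 1 ∷ 0 ∷ 0 ∷ 0 ∷ 0 ∷ 0 ∷ []) ∷ []
Y₁ = (1ℚ , 0 ∷ 1 ∷ 0 ∷ 0 ∷ 0 ∷ 0 ∷ []) ∷ []
X₂ = (1ℚ , 0 ∷ 0 ∷ 1 ∷ 0 ∷ 0 ∷ 0 ∷ []) ∷ []
Y₂ = (1ℚ , 0 ∷ 0 ∷ 0 ∷ 1 ∷ 0 ∷ 0 ∷ []) ∷ []
X₃ = (1ℚ , 0 ∷ 0 ∷ 0 ∷ 0 ∷ 1 ∷ 0 ∷ []) ∷ []
Y₃ = (1ℚ , 0 ∷ 0 ∷ 0 ∷ 0 ∷ 0 ∷ 1 ∷ []) ∷ []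

infixl 6 _+P_ _-P_
infixl 7 _*P_
infixr 8 _^P_

_+P_ : Poly → Poly → Poly
p +P q = p ++ q

negP : Poly → Poly
negP = map (λ { (c , e) → (- c , e) })

_-P_ : Poly → Poly → Poly
p -P q = p +P negP q

_*P_ : Poly → Poly → Poly
p *P q = concatMap (λ { (c , e) → map (λ { (d , f) → (c * d , zipWith ℕ._+_ e f) }) q }) p

_^P_ : Poly → ℕ → Poly
p ^P zero  = one
p ^P suc n = p *P (p ^P n)

-- The pairing ⟨·,·⟩_κ on L_κ on monomials:
-- ⟨X^i Y^(κ-i), X^j Y^(κ-j)⟩_κ = (-1)^i / binom(κ,i) if i + j = κ, else 0.
-- Here 1 / binom(κ,i) is written as i! (κ-i)! / κ!.
-- Monomials not of degree κ (not in L_κ) pair to 0.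

sgn : ℕ → ℚ
sgn zero    = 1ℚ
sgn (suc n) = - sgn n

pair₁ : (κ i b j b′ : ℕ) → ℚ
pair₁ κ i b j b′ with i ℕ.+ b ≟ κ | j ℕ.+ b′ ≟ κ | i ℕ.+ j ≟ κ
... | yes _ | yes _ | yes _ =
  sgn i * ((+ (i ! ℕ.* (κ ∸ i) !)) / (κ !)) {{κ !≢0}}
... | _ | _ | _ = 0ℚ

pairMono : (κ₁ κ₂ κ₃ : ℕ) → Exps → Exps → ℚ
pairMono κ₁ κ₂ κ₃ (a₁ ∷ b₁ ∷ a₂ ∷ b₂ ∷ a₃ ∷ b₃ ∷ []) (c₁ ∷ d₁ ∷ c₂ ∷ d₂ ∷ c₃ ∷ d₃ ∷ []) =
  pair₁ κ₁ a₁ b₁ c₁ d₁ * pair₁ κ₂ a₂ b₂ c₂ d₂ * pair₁ κ₃ a₃ b₃ c₃ d₃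

sumℚ : List ℚ → ℚ
sumℚ = foldr _+_ 0ℚ

pairing : (κ₁ κ₂ κ₃ : ℕ) → Poly → Poly → ℚ
pairing κ₁ κ₂ κ₃ p q =
  sumℚ (concatMap (λ { (c , e) → map (λ { (d , f) → c * d * pairMono κ₁ κ₂ κ₃ e f }) q }) p)

Pκ : (k₁* k₂* k₃* : ℕ) → Poly
Pκ k₁* k₂* k₃* =
  ((X₁ *P Y₂ -P X₂ *P Y₁) ^P k₃*) *P ((X₃ *P Y₁ -P X₁ *P Y₃) ^P k₂*) *P ((X₃ *P Y₂ -P X₂ *P Y₃) ^P k₁*)

open import Data.Nat using (NonZero)
open import Data.Nat.Properties using (m*n≢0)

nz3 : ∀ a b c → NonZero (a ! ℕ.* b ! ℕ.* c !)
nz3 a b c = m*n≢0 (a ! ℕ.* b !) (c !) {{a !* b !≢0}} {{c !≢0}}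

module Submission where

-- Write a = κ₁*, b = κ₂*, c = κ₃*, so κ₁ = b + c, κ₂ = a + c, κ₃ = a + b and
-- P_κ = A^c B^b C^a for the brackets A = X₁Y₂ - X₂Y₁, B = X₃Y₁ - X₁Y₃, C = X₃Y₂ - X₂Y₃.
-- The proof is the classical one by Cayley's Ω-process:
--  * multiplication by Xᵢ (resp. Yᵢ) is adjoint for the pairing to -1/κᵢ ∂/∂Yᵢ
--    (resp. 1/κᵢ ∂/∂Xᵢ), so multiplication by a bracket x w - u y is adjoint to a
--    multiple of Ω = ∂x ∂w - ∂u ∂y  (adjoint-var, bracket-adjoint);
--  * Cayley's identity: if Ω G = 0 and G is homogeneous in the two pairs of variables
--    of the bracket Q, then Ω (Q^{n+1} G) = (n+1)(n+2+deg G) Q^n G  (module Cayley);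
--  * so ⟨Q P′, Q P′⟩ is an explicit multiple of ⟨P′, P′⟩ (peel), and removing the
--    A's, then the B's, then the C's gives R(a,b,c) by induction (norm).

open import Defs

open import Data.Nat as ℕ using (ℕ; zero; suc; _!; _≟_)
import Data.Nat.Properties as ℕP
open import Data.Nat.Properties using (_!≢0)
import Data.Nat.Tactic.RingSolver as ℕ-Solver
open import Data.Integer as ℤ using (+_)
import Data.Integer.Properties as ℤP
open import Data.Rational using (ℚ; 0ℚ; 1ℚ; fromℚᵘ)
import Data.Rational.Properties as ℚP
open import Data.Rational.Unnormalised as ℚᵘ using (mkℚᵘ; *≡*)
import Data.Rational.Unnormalised.Properties as ℚᵘP
open import Data.List using ([]; _∷_; map; _++_)
import Data.List.Properties as ListP
open import Data.List.Relation.Unary.All using (All; []; _∷_)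
open import Data.Vec using (Vec; []; _∷_; zipWith; replicate; lookup; updateAt)
import Data.Vec.Properties as VecP
open import Data.Fin using (Fin; zero; suc)
open import Data.Product using (_×_; _,_; proj₁; proj₂)
open import Data.Maybe using (Maybe; nothing; just)
open import Function using (_∘_)
open import Relation.Nullary using (¬_; yes; no; contradiction)
open import Relation.Nullary.Decidable using (_×-dec_)
open import Relation.Binary.PropositionalEquality
open import Relation.Binary.Bundles using (Setoid)
import Relation.Binary.Reasoning.Setoid as SetoidReasoning
open import Tactic.RingSolver using (solve-∀)
open import Tactic.RingSolver.Core.AlmostCommutativeRing
  using (AlmostCommutativeRing; fromCommutativeRing)

module _ where

  open import Data.Rational using (_+_; _*_; -_; _/_)

  ℚ-ring : AlmostCommutativeRing _ _
  ℚ-ring = fromCommutativeRing ℚP.+-*-commutativeRing (λ _ → nothing)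

  ι : ℕ → ℚ
  ι n = + n / 1

  fromℚᵘ-* : ∀ p q → fromℚᵘ p * fromℚᵘ q ≡ fromℚᵘ (p ℚᵘ.* q)
  fromℚᵘ-* p q = ℚP.toℚᵘ-injective (ℚᵘP.≃-trans (ℚP.toℚᵘ-homo-* (fromℚᵘ p) (fromℚᵘ q))
    (ℚᵘP.≃-trans (ℚᵘP.*-cong (ℚP.toℚᵘ-fromℚᵘ p) (ℚP.toℚᵘ-fromℚᵘ q)) (ℚᵘP.≃-sym (ℚP.toℚᵘ-fromℚᵘ _))))

  fromℚᵘ-+ : ∀ p q → fromℚᵘ p + fromℚᵘ q ≡ fromℚᵘ (p ℚᵘ.+ q)
  fromℚᵘ-+ p q = ℚP.toℚᵘ-injective (ℚᵘP.≃-trans (ℚP.toℚᵘ-homo-+ (fromℚᵘ p) (fromℚᵘ q))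
    (ℚᵘP.≃-trans (ℚᵘP.+-cong (ℚP.toℚᵘ-fromℚᵘ p) (ℚP.toℚᵘ-fromℚᵘ q)) (ℚᵘP.≃-sym (ℚP.toℚᵘ-fromℚᵘ _))))

  /-* : ∀ a b c d .{{_ : ℕ.NonZero b}} .{{_ : ℕ.NonZero d}} →
        (+ a / b) * (+ c / d) ≡ (+ (a ℕ.* c) / (b ℕ.* d)) {{ℕP.m*n≢0 b d}}
  /-* a (suc b) c (suc d) = trans (fromℚᵘ-* (mkℚᵘ (+ a) b) (mkℚᵘ (+ c) d))
    (cong (λ n → fromℚᵘ (mkℚᵘ n (d ℕ.+ b ℕ.* suc d))) (sym (ℤP.pos-* a c)))

  /-cross : ∀ a b c d .{{_ : ℕ.NonZero b}} .{{_ : ℕ.NonZero d}} →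
            a ℕ.* d ≡ c ℕ.* b → + a / b ≡ + c / d
  /-cross a (suc b) c (suc d) eq = ℚP.fromℚᵘ-cong {mkℚᵘ (+ a) b} {mkℚᵘ (+ c) d} (*≡* (begin
      + a ℤ.* + suc d   ≡⟨ ℤP.pos-* a (suc d) ⟨
      + (a ℕ.* suc d)   ≡⟨ cong +_ eq ⟩
      + (c ℕ.* suc b)   ≡⟨ ℤP.pos-* c (suc b) ⟩
      + c ℤ.* + suc b   ∎))
    where open ≡-Reasoning

  ι-+ : ∀ m n → ι (m ℕ.+ n) ≡ ι m + ι n
  ι-+ m n = sym (trans (fromℚᵘ-+ (mkℚᵘ (+ m) 0) (mkℚᵘ (+ n) 0))
    (ℚP.fromℚᵘ-cong {mkℚᵘ (+ m) 0 ℚᵘ.+ mkℚᵘ (+ n) 0} {mkℚᵘ (+ (m ℕ.+ n)) 0} (*≡* (cong (ℤ._* + 1) (begin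
      + m ℤ.* + 1 ℤ.+ + n ℤ.* + 1   ≡⟨ cong₂ ℤ._+_ (ℤP.*-identityʳ (+ m)) (ℤP.*-identityʳ (+ n)) ⟩
      + m ℤ.+ + n                   ≡⟨ ℤP.pos-+ m n ⟨
      + (m ℕ.+ n)                   ∎)))))
    where open ≡-Reasoning

  ι-/ : ∀ m N D .{{_ : ℕ.NonZero D}} → ι m * (+ N / D) ≡ + (m ℕ.* N) / D
  ι-/ m N (suc D) = trans (/-* m 1 N (suc D))
    (/-cross (m ℕ.* N) (1 ℕ.* suc D) (m ℕ.* N) (suc D) (cong (m ℕ.* N ℕ.*_) (sym (ℕP.*-identityˡ (suc D)))))

  -- inv k = 1/(k+1): the pairing on L_{k+1} is the pairing on L_k rescaled by these factors.
  inv : ℕ → ℚ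
  inv k = + 1 / suc k

  inv-/ : ∀ k N D .{{_ : ℕ.NonZero D}} → inv k * (+ N / D) ≡ (+ N / (suc k ℕ.* D)) {{ℕP.m*n≢0 (suc k) D}}
  inv-/ k N (suc D) = trans (/-* 1 (suc k) N (suc D)) (cong (λ n → + n / (suc k ℕ.* suc D)) (ℕP.*-identityˡ N))

  infixl 6 _⊕_
  _⊕_ : Exps → Exps → Exps
  e ⊕ f = zipWith ℕ._+_ e f

  ⊕-assoc : ∀ a b c → (a ⊕ b) ⊕ c ≡ a ⊕ (b ⊕ c)
  ⊕-assoc = VecP.zipWith-assoc ℕP.+-assoc

  ⊕-comm : ∀ a b → a ⊕ b ≡ b ⊕ a
  ⊕-comm = VecP.zipWith-comm ℕP.+-comm

  𝟘 : Exps
  𝟘 = replicate 6 0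

  ⊕-identityˡ : ∀ a → 𝟘 ⊕ a ≡ a
  ⊕-identityˡ = VecP.zipWith-identityˡ ℕP.+-identityˡ

  L : (Exps → ℚ) → Poly → ℚ
  L h [] = 0ℚ
  L h ((c , e) ∷ p) = c * h e + L h p

  L-cong : ∀ {h k} → (∀ e → h e ≡ k e) → ∀ p → L h p ≡ L k p
  L-cong eq [] = refl
  L-cong eq ((c , e) ∷ p) = cong₂ (λ a b → c * a + b) (eq e) (L-cong eq p)

  L-++ : ∀ h p q → L h (p ++ q) ≡ L h p + L h q
  L-++ h [] q = sym (ℚP.+-identityˡ _)
  L-++ h ((c , e) ∷ p) q = trans (cong (λ z → c * h e + z) (L-++ h p q)) (sym (ℚP.+-assoc (c * h e) (L h p) (L h q)))

  L-neg : ∀ h p → L h (negP p) ≡ - L h p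
  L-neg h [] = refl
  L-neg h ((c , e) ∷ p) =
    trans (cong₂ _+_ (sym (ℚP.neg-distribˡ-* c (h e))) (L-neg h p)) (sym (ℚP.neg-distrib-+ (c * h e) (L h p)))

  L-0 : ∀ p → L (λ _ → 0ℚ) p ≡ 0ℚ
  L-0 [] = refl
  L-0 ((c , e) ∷ p) = trans (cong₂ _+_ (ℚP.*-zeroʳ c) (L-0 p)) (ℚP.+-identityˡ 0ℚ)

  L-+ : ∀ h k p → L (λ e → h e + k e) p ≡ L h p + L k p
  L-+ h k [] = refl
  L-+ h k ((c , e) ∷ p) =
    trans (cong (λ z → c * (h e + k e) + z) (L-+ h k p)) (interchange c (h e) (k e) (L h p) (L k p))
    where
      interchange : ∀ c a b x y → c * (a + b) + (x + y) ≡ (c * a + x) + (c * b + y)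
      interchange = solve-∀ ℚ-ring

  L-* : ∀ r h p → L (λ e → r * h e) p ≡ r * L h p
  L-* r h [] = sym (ℚP.*-zeroʳ r)
  L-* r h ((c , e) ∷ p) = trans (cong (λ z → c * (r * h e) + z) (L-* r h p)) (factor r c (h e) (L h p))
    where
      factor : ∀ r c a x → c * (r * a) + r * x ≡ r * (c * a + x)
      factor = solve-∀ ℚ-ring

  L-- : ∀ h p → L (λ e → - h e) p ≡ - L h p
  L-- h [] = refl
  L-- h ((c , e) ∷ p) = trans (cong (λ z → c * (- h e) + z) (L-- h p)) (factor c (h e) (L h p))
    where
      factor : ∀ c a x → c * (- a) + (- x) ≡ - (c * a + x)
      factor = solve-∀ ℚ-ring

  L-swap : ∀ (k : Exps → Exps → ℚ) p q → L (λ e → L (k e) q) p ≡ L (λ f → L (λ e → k e f) p) q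
  L-swap k [] q = sym (L-0 q)
  L-swap k ((c , e) ∷ p) q = begin
      c * L (k e) q + L (λ e → L (k e) q) p
    ≡⟨ cong₂ _+_ (sym (L-* c (k e) q)) (L-swap k p q) ⟩
      L (λ f → c * k e f) q + L (λ f → L (λ e → k e f) p) q
    ≡⟨ sym (L-+ _ _ q) ⟩
      L (λ f → c * k e f + L (λ e → k e f) p) q ∎
    where open ≡-Reasoning

  L-*P : ∀ h p q → L h (p *P q) ≡ L (λ e → L (λ f → h (e ⊕ f)) q) p
  L-*P h [] q = refl
  L-*P h ((c , e) ∷ p) q = trans (L-++ h (map (scale c e) q) (p *P q)) (cong₂ _+_ (L-scale q) (L-*P h p q))
    where
      scale : ℚ → Exps → ℚ × Exps → ℚ × Exps
      scale c e (d , f) = (c * d , e ⊕ f)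
      L-scale : ∀ q → L h (map (scale c e) q) ≡ c * L (λ f → h (e ⊕ f)) q
      L-scale [] = sym (ℚP.*-zeroʳ c)
      L-scale ((d , f) ∷ q) = trans (cong (λ z → c * d * h (e ⊕ f) + z) (L-scale q)) (factor c d (h (e ⊕ f)) _)
        where
          factor : ∀ c d a x → c * d * a + c * x ≡ c * (d * a + x)
          factor = solve-∀ ℚ-ring

  -- Two formal sums are equal as polynomials when every functional L h
  -- agrees on them (taking h the indicator of a monomial recovers its coefficient).
  infix 4 _≈_
  record _≈_ (p q : Poly) : Set where
    constructor ≈-by
    field L-≈ : ∀ h → L h p ≡ L h q
  open _≈_ public

  ≈-refl : ∀ {p} → p ≈ p
  ≈-refl = ≈-by (λ h → refl)

  ≈-sym : ∀ {p q} → p ≈ q → q ≈ p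
  ≈-sym (≈-by f) = ≈-by (λ h → sym (f h))

  ≈-trans : ∀ {p q r} → p ≈ q → q ≈ r → p ≈ r
  ≈-trans (≈-by f) (≈-by g) = ≈-by (λ h → trans (f h) (g h))

  ≈-reflexive : ∀ {p q} → p ≡ q → p ≈ q
  ≈-reflexive refl = ≈-refl

  polySetoid : Setoid _ _
  polySetoid = record
    { Carrier = Poly
    ; _≈_ = _≈_
    ; isEquivalence = record { refl = ≈-refl ; sym = ≈-sym ; trans = ≈-trans }
    }

  +P-cong : ∀ {p p′ q q′} → p ≈ p′ → q ≈ q′ → p +P q ≈ p′ +P q′
  +P-cong {p} {p′} {q} {q′} (≈-by f) (≈-by g) =
    ≈-by (λ h → trans (L-++ h p q) (trans (cong₂ _+_ (f h) (g h)) (sym (L-++ h p′ q′))))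

  *P-cong : ∀ {p p′ q q′} → p ≈ p′ → q ≈ q′ → p *P q ≈ p′ *P q′
  *P-cong {p} {p′} {q} {q′} (≈-by f) (≈-by g) =
    ≈-by (λ h → trans (L-*P h p q) (trans (L-cong (λ e → g (λ f → h (e ⊕ f))) p) (trans (f _) (sym (L-*P h p′ q′)))))

  +P-congˡ : ∀ {p p′} q → p ≈ p′ → p +P q ≈ p′ +P q
  +P-congˡ q p≈p′ = +P-cong p≈p′ (≈-refl {q})

  +P-congʳ : ∀ p {q q′} → q ≈ q′ → p +P q ≈ p +P q′
  +P-congʳ p q≈q′ = +P-cong (≈-refl {p}) q≈q′

  *P-congˡ : ∀ {p p′} q → p ≈ p′ → p *P q ≈ p′ *P q
  *P-congˡ q p≈p′ = *P-cong p≈p′ (≈-refl {q})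

  *P-congʳ : ∀ p {q q′} → q ≈ q′ → p *P q ≈ p *P q′
  *P-congʳ p q≈q′ = *P-cong (≈-refl {p}) q≈q′

  negP-cong : ∀ {p q} → p ≈ q → negP p ≈ negP q
  negP-cong {p} {q} (≈-by f) = ≈-by (λ h → trans (L-neg h p) (trans (cong -_ (f h)) (sym (L-neg h q))))

  -P-cong : ∀ {p p′ q q′} → p ≈ p′ → q ≈ q′ → p -P q ≈ p′ -P q′
  -P-cong pp qq = +P-cong pp (negP-cong qq)

  +P-assoc : ∀ p q r → (p +P q) +P r ≈ p +P (q +P r)
  +P-assoc p q r = ≈-reflexive (ListP.++-assoc p q r)

  +P-comm : ∀ p q → p +P q ≈ q +P p
  +P-comm p q = ≈-by (λ h → trans (L-++ h p q) (trans (ℚP.+-comm (L h p) (L h q)) (sym (L-++ h q p))))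

  +P-identityʳ : ∀ p → p +P [] ≈ p
  +P-identityʳ p = ≈-reflexive (ListP.++-identityʳ p)

  *P-assoc : ∀ p q r → (p *P q) *P r ≈ p *P (q *P r)
  *P-assoc p q r = ≈-by (λ h → begin
      L h ((p *P q) *P r)
    ≡⟨ trans (L-*P h (p *P q) r) (L-*P _ p q) ⟩
      L (λ e₁ → L (λ e₂ → L (λ f → h ((e₁ ⊕ e₂) ⊕ f)) r) q) p
    ≡⟨ L-cong (λ e₁ → L-cong (λ e₂ → L-cong (λ f → cong h (⊕-assoc e₁ e₂ f)) r) q) p ⟩
      L (λ e₁ → L (λ e₂ → L (λ f → h (e₁ ⊕ (e₂ ⊕ f))) r) q) p
    ≡⟨ L-cong (λ e₁ → sym (L-*P (λ g → h (e₁ ⊕ g)) q r)) p ⟩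
      L (λ e₁ → L (λ g → h (e₁ ⊕ g)) (q *P r)) p
    ≡⟨ sym (L-*P h p (q *P r)) ⟩
      L h (p *P (q *P r)) ∎)
    where open ≡-Reasoning

  *P-comm : ∀ p q → p *P q ≈ q *P p
  *P-comm p q = ≈-by (λ h → begin
      L h (p *P q)
    ≡⟨ L-*P h p q ⟩
      L (λ e → L (λ f → h (e ⊕ f)) q) p
    ≡⟨ L-swap (λ e f → h (e ⊕ f)) p q ⟩
      L (λ f → L (λ e → h (e ⊕ f)) p) q
    ≡⟨ L-cong (λ f → L-cong (λ e → cong h (⊕-comm e f)) p) q ⟩
      L (λ f → L (λ e → h (f ⊕ e)) p) q
    ≡⟨ sym (L-*P h q p) ⟩
      L h (q *P p) ∎)
    where open ≡-Reasoning

  *P-identityˡ : ∀ p → one *P p ≈ p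
  *P-identityˡ p = ≈-by (λ h → trans (L-*P h one p)
    (trans (ℚP.+-identityʳ _) (trans (ℚP.*-identityˡ _) (L-cong (λ f → cong h (⊕-identityˡ f)) p))))

  *P-distribˡ : ∀ p q r → p *P (q +P r) ≈ p *P q +P p *P r
  *P-distribˡ p q r = ≈-by (λ h → begin
      L h (p *P (q +P r))
    ≡⟨ L-*P h p (q +P r) ⟩
      L (λ e → L (λ f → h (e ⊕ f)) (q ++ r)) p
    ≡⟨ L-cong (λ e → L-++ _ q r) p ⟩
      L (λ e → L (λ f → h (e ⊕ f)) q + L (λ f → h (e ⊕ f)) r) p
    ≡⟨ L-+ _ _ p ⟩
      L (λ e → L (λ f → h (e ⊕ f)) q) p + L (λ e → L (λ f → h (e ⊕ f)) r) p
    ≡⟨ sym (cong₂ _+_ (L-*P h p q) (L-*P h p r)) ⟩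
      L h (p *P q) + L h (p *P r)
    ≡⟨ sym (L-++ h (p *P q) (p *P r)) ⟩
      L h (p *P q +P p *P r) ∎)
    where open ≡-Reasoning

  *P-zeroʳ : ∀ p → p *P [] ≈ []
  *P-zeroʳ p = ≈-by (λ h → trans (L-*P h p []) (L-0 p))

  negP-*P : ∀ p q → negP p *P q ≈ negP (p *P q)
  negP-*P p q = ≈-by (λ h → trans (L-*P h (negP p) q)
    (trans (L-neg _ p) (trans (cong -_ (sym (L-*P h p q))) (sym (L-neg h (p *P q))))))

  negP-+P : ∀ p q → negP p +P negP q ≈ negP (p +P q)
  negP-+P p q = ≈-by (λ h → trans (L-++ h (negP p) (negP q)) (trans (cong₂ _+_ (L-neg h p) (L-neg h q))
    (trans (sym (ℚP.neg-distrib-+ (L h p) (L h q))) (trans (cong -_ (sym (L-++ h p q))) (sym (L-neg h (p +P q)))))))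

  -P-self : ∀ p → p -P p ≈ []
  -P-self p = ≈-by (λ h →
    trans (L-++ h p (negP p)) (trans (cong (λ z → L h p + z) (L-neg h p)) (ℚP.+-inverseʳ (L h p))))

  -- Hence Poly is a commutative ring up to ≈, and the ring solver applies to it
  -- (the solver recognises the empty sum as the constant zero).
  is-[] : (p : Poly) → Maybe ([] ≈ p)
  is-[] [] = just ≈-refl
  is-[] (_ ∷ _) = nothing

  polyRing : AlmostCommutativeRing _ _
  polyRing = record
    { Carrier = Poly
    ; _≈_ = _≈_
    ; _+_ = _+P_
    ; _*_ = _*P_
    ; -_ = negP
    ; 0# = []
    ; 0≟_ = is-[]
    ; 1# = one
    ; isAlmostCommutativeRing = record
      { isCommutativeSemiring = record
        { isSemiring = record
          { isSemiringWithoutAnnihilatingZero = record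
            { +-isCommutativeMonoid = record
              { isMonoid = record
                { isSemigroup = record
                  { isMagma = record { isEquivalence = Setoid.isEquivalence polySetoid ; ∙-cong = +P-cong }
                  ; assoc = +P-assoc }
                ; identity = (λ p → ≈-refl) , +P-identityʳ }
              ; comm = +P-comm }
            ; *-cong = *P-cong
            ; *-assoc = *P-assoc
            ; *-identity = *P-identityˡ , (λ p → ≈-trans (*P-comm p one) (*P-identityˡ p))
            ; distrib = *P-distribˡ , (λ p q r → ≈-trans (*P-comm (q +P r) p)
                          (≈-trans (*P-distribˡ p q r) (+P-cong (*P-comm p q) (*P-comm p r)))) }
          ; zero = (λ p → ≈-refl) , *P-zeroʳ }
        ; *-comm = *P-comm }
      ; -‿cong = negP-cong
      ; -‿*-distribˡ = negP-*P
      ; -‿+-comm = negP-+P } }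

  cst : ℚ → Poly
  cst r = (r , 𝟘) ∷ []

  ⌜_⌝ : ℕ → Poly
  ⌜ n ⌝ = cst (ι n)

  L-cst-*P : ∀ h r p → L h (cst r *P p) ≡ r * L h p
  L-cst-*P h r p = trans (L-*P h (cst r) p)
    (trans (ℚP.+-identityʳ _) (cong (r *_) (L-cong (λ f → cong h (⊕-identityˡ f)) p)))

  ⌜⌝-+ : ∀ m n → ⌜ m ℕ.+ n ⌝ ≈ ⌜ m ⌝ +P ⌜ n ⌝
  ⌜⌝-+ m n = ≈-by (λ h → trans (cong (λ r → r * h 𝟘 + 0ℚ) (ι-+ m n)) (distrib (ι m) (ι n) (h 𝟘)))
    where
      distrib : ∀ r s a → (r + s) * a + 0ℚ ≡ r * a + (s * a + 0ℚ)
      distrib = solve-∀ ℚ-ring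

  lower : Fin 6 → Exps → Exps
  lower v e = updateAt e v ℕ.pred

  ∂ : Fin 6 → Poly → Poly
  ∂ v [] = []
  ∂ v ((c , e) ∷ p) = (c * ι (lookup e v) , lower v e) ∷ ∂ v p

  L-∂ : ∀ h v p → L h (∂ v p) ≡ L (λ e → ι (lookup e v) * h (lower v e)) p
  L-∂ h v [] = refl
  L-∂ h v ((c , e) ∷ p) = cong₂ _+_ (ℚP.*-assoc c (ι (lookup e v)) _) (L-∂ h v p)

  ∂-cong : ∀ v {p q} → p ≈ q → ∂ v p ≈ ∂ v q
  ∂-cong v {p} {q} (≈-by f) = ≈-by (λ h → trans (L-∂ h v p) (trans (f _) (sym (L-∂ h v q))))

  ∂-+P : ∀ v p q → ∂ v (p +P q) ≈ ∂ v p +P ∂ v q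
  ∂-+P v p q = ≈-by (λ h → trans (L-∂ h v (p ++ q))
    (trans (L-++ _ p q) (trans (cong₂ _+_ (sym (L-∂ h v p)) (sym (L-∂ h v q))) (sym (L-++ h (∂ v p) (∂ v q))))))

  ∂-negP : ∀ v p → ∂ v (negP p) ≈ negP (∂ v p)
  ∂-negP v p = ≈-by (λ h → trans (L-∂ h v (negP p))
    (trans (L-neg _ p) (trans (cong -_ (sym (L-∂ h v p))) (sym (L-neg h (∂ v p))))))

  lower-⊕ˡ : ∀ {n} (e f : Vec ℕ n) v {k} → lookup e v ≡ suc k →
             updateAt (zipWith ℕ._+_ e f) v ℕ.pred ≡ zipWith ℕ._+_ (updateAt e v ℕ.pred) f
  lower-⊕ˡ (suc x ∷ e) (y ∷ f) zero eq = refl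
  lower-⊕ˡ (x ∷ e) (y ∷ f) (suc v) eq = cong (x ℕ.+ y ∷_) (lower-⊕ˡ e f v eq)

  lower-⊕ʳ : ∀ {n} (e f : Vec ℕ n) v {k} → lookup f v ≡ suc k →
             updateAt (zipWith ℕ._+_ e f) v ℕ.pred ≡ zipWith ℕ._+_ e (updateAt f v ℕ.pred)
  lower-⊕ʳ (x ∷ e) (suc y ∷ f) zero eq = cong (_∷ zipWith ℕ._+_ e f) (cong ℕ.pred (ℕP.+-suc x y))
  lower-⊕ʳ (x ∷ e) (y ∷ f) (suc v) eq = cong (x ℕ.+ y ∷_) (lower-⊕ʳ e f v eq)

  ι-*-guard : ∀ n {a b : ℚ} → (∀ {k} → n ≡ suc k → a ≡ b) → ι n * a ≡ ι n * b
  ι-*-guard zero {a} {b} _ = trans (ℚP.*-zeroˡ a) (sym (ℚP.*-zeroˡ b))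
  ι-*-guard (suc k) eq = cong (ι (suc k) *_) (eq refl)

  leibniz-monomial : ∀ h v e f →
    ι (lookup (e ⊕ f) v) * h (lower v (e ⊕ f))
      ≡ ι (lookup e v) * h (lower v e ⊕ f) + ι (lookup f v) * h (e ⊕ lower v f)
  leibniz-monomial h v e f = begin
      ι (lookup (e ⊕ f) v) * h (lower v (e ⊕ f))
    ≡⟨ cong (λ n → ι n * h (lower v (e ⊕ f))) (VecP.lookup-zipWith ℕ._+_ v e f) ⟩
      ι (lookup e v ℕ.+ lookup f v) * h (lower v (e ⊕ f))
    ≡⟨ trans (cong (_* h (lower v (e ⊕ f))) (ι-+ (lookup e v) (lookup f v)))
             (ℚP.*-distribʳ-+ (h (lower v (e ⊕ f))) (ι (lookup e v)) (ι (lookup f v))) ⟩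
      ι (lookup e v) * h (lower v (e ⊕ f)) + ι (lookup f v) * h (lower v (e ⊕ f))
    ≡⟨ cong₂ _+_ (ι-*-guard (lookup e v) (λ eq → cong h (lower-⊕ˡ e f v eq)))
                 (ι-*-guard (lookup f v) (λ eq → cong h (lower-⊕ʳ e f v eq))) ⟩
      ι (lookup e v) * h (lower v e ⊕ f) + ι (lookup f v) * h (e ⊕ lower v f) ∎
    where open ≡-Reasoning

  leibniz : ∀ v p q → ∂ v (p *P q) ≈ ∂ v p *P q +P p *P ∂ v q
  leibniz v p q = ≈-by (λ h → begin
      L h (∂ v (p *P q))
    ≡⟨ trans (L-∂ h v (p *P q)) (L-*P _ p q) ⟩
      L (λ e → L (λ f → ι (lookup (e ⊕ f) v) * h (lower v (e ⊕ f))) q) p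
    ≡⟨ L-cong (λ e → trans (L-cong (λ f → leibniz-monomial h v e f) q) (L-+ _ _ q)) p ⟩
      L (λ e → L (λ f → ι (lookup e v) * h (lower v e ⊕ f)) q + L (λ f → ι (lookup f v) * h (e ⊕ lower v f)) q) p
    ≡⟨ L-+ _ _ p ⟩
      L (λ e → L (λ f → ι (lookup e v) * h (lower v e ⊕ f)) q) p
        + L (λ e → L (λ f → ι (lookup f v) * h (e ⊕ lower v f)) q) p
    ≡⟨ cong₂ _+_ (L-cong (λ e → L-* (ι (lookup e v)) (λ f → h (lower v e ⊕ f)) q) p)
                 (L-cong (λ e → sym (L-∂ _ v q)) p) ⟩
      L (λ e → ι (lookup e v) * L (λ f → h (lower v e ⊕ f)) q) p + L (λ e → L (λ f → h (e ⊕ f)) (∂ v q)) p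
    ≡⟨ cong₂ _+_ (trans (sym (L-∂ _ v p)) (sym (L-*P h (∂ v p) q))) (sym (L-*P h p (∂ v q))) ⟩
      L h (∂ v p *P q) + L h (p *P ∂ v q)
    ≡⟨ sym (L-++ h (∂ v p *P q) (p *P ∂ v q)) ⟩
      L h (∂ v p *P q +P p *P ∂ v q) ∎)
    where open ≡-Reasoning

  unit : Fin 6 → Exps
  unit v = updateAt 𝟘 v suc

  var : Fin 6 → Poly
  var v = (1ℚ , unit v) ∷ []

  ∂-var-self : ∀ v → ∂ v (var v) ≈ one
  ∂-var-self v = ≈-by (λ h → cong₂ (λ n e → 1ℚ * ι n * h e + 0ℚ) exponent lowered)
    where
      exponent : lookup (unit v) v ≡ 1
      exponent = trans (VecP.lookup∘updateAt v 𝟘) (cong suc (VecP.lookup-replicate v 0))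
      lowered : lower v (unit v) ≡ 𝟘
      lowered = trans (VecP.updateAt-updateAt v 𝟘) (VecP.updateAt-id v 𝟘)

  ∂-var-other : ∀ v w → v ≢ w → ∂ v (var w) ≈ []
  ∂-var-other v w v≢w = ≈-by (λ h → begin
      1ℚ * ι (lookup (unit w) v) * h (lower v (unit w)) + 0ℚ
    ≡⟨ cong (λ n → 1ℚ * ι n * h (lower v (unit w)) + 0ℚ)
            (trans (VecP.lookup∘updateAt′ v w v≢w 𝟘) (VecP.lookup-replicate v 0)) ⟩
      1ℚ * 0ℚ * h (lower v (unit w)) + 0ℚ
    ≡⟨ cong (_+ 0ℚ) (ℚP.*-zeroˡ (h (lower v (unit w)))) ⟩
      0ℚ ∎)
    where open ≡-Reasoning

  ∂-cst : ∀ v r → ∂ v (cst r) ≈ []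
  ∂-cst v r = ≈-by (λ h → begin
      r * ι (lookup 𝟘 v) * h (lower v 𝟘) + 0ℚ
    ≡⟨ cong (λ n → r * ι n * h (lower v 𝟘) + 0ℚ) (VecP.lookup-replicate v 0) ⟩
      r * 0ℚ * h (lower v 𝟘) + 0ℚ
    ≡⟨ cong (λ x → x * h (lower v 𝟘) + 0ℚ) (ℚP.*-zeroʳ r) ⟩
      0ℚ * h (lower v 𝟘) + 0ℚ
    ≡⟨ cong (_+ 0ℚ) (ℚP.*-zeroˡ (h (lower v 𝟘))) ⟩
      0ℚ ∎)
    where open ≡-Reasoning

  ∂-^ : ∀ v p n → ∂ v (p ^P suc n) ≈ ⌜ suc n ⌝ *P p ^P n *P ∂ v p
  ∂-^ v p zero = begin
      ∂ v (p *P one)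
    ≈⟨ leibniz v p one ⟩
      ∂ v p *P one +P p *P ∂ v one
    ≈⟨ +P-cong ≈-refl (*P-cong {p} ≈-refl (∂-cst v 1ℚ)) ⟩
      ∂ v p *P one +P p *P []
    ≈⟨ simplify (∂ v p) p ⟩
      one *P one *P ∂ v p ∎
    where
      open SetoidReasoning polySetoid
      simplify : ∀ d p → d *P one +P p *P [] ≈ one *P one *P d
      simplify = solve-∀ polyRing
  ∂-^ v p (suc n) = begin
      ∂ v (p *P p ^P suc n)
    ≈⟨ leibniz v p (p ^P suc n) ⟩
      ∂ v p *P p ^P suc n +P p *P ∂ v (p ^P suc n)
    ≈⟨ +P-cong ≈-refl (*P-cong {p} ≈-refl (∂-^ v p n)) ⟩
      ∂ v p *P (p *P p ^P n) +P p *P (⌜ suc n ⌝ *P p ^P n *P ∂ v p)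
    ≈⟨ collect (∂ v p) p (p ^P n) ⌜ suc n ⌝ ⟩
      (one +P ⌜ suc n ⌝) *P (p *P p ^P n) *P ∂ v p
    ≈⟨ *P-cong (*P-cong {q = p ^P suc n} (≈-sym (⌜⌝-+ 1 (suc n))) ≈-refl) (≈-refl {∂ v p}) ⟩
      ⌜ suc (suc n) ⌝ *P p ^P suc n *P ∂ v p ∎
    where
      open SetoidReasoning polySetoid
      collect : ∀ d p q c → d *P (p *P q) +P p *P (c *P q *P d) ≈ (one +P c) *P (p *P q) *P d
      collect = solve-∀ polyRing

  Deg : (Exps → ℕ) → ℕ → Poly → Set
  Deg φ d p = All (λ t → φ (proj₂ t) ≡ d) p

  Additive : (Exps → ℕ) → Set
  Additive φ = (∀ e f → φ (e ⊕ f) ≡ φ e ℕ.+ φ f) × φ 𝟘 ≡ 0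

  degIn : Fin 6 → Exps → ℕ
  degIn v e = lookup e v

  degIn₂ : Fin 6 → Fin 6 → Exps → ℕ
  degIn₂ v w e = lookup e v ℕ.+ lookup e w

  degIn-additive : ∀ v → Additive (degIn v)
  degIn-additive v = (λ e f → VecP.lookup-zipWith ℕ._+_ v e f) , VecP.lookup-replicate v 0

  degIn₂-additive : ∀ v w → Additive (degIn₂ v w)
  degIn₂-additive v w = additive , cong₂ ℕ._+_ (VecP.lookup-replicate v 0) (VecP.lookup-replicate w 0)
    where
      interchange : ∀ a b c d → (a ℕ.+ b) ℕ.+ (c ℕ.+ d) ≡ (a ℕ.+ c) ℕ.+ (b ℕ.+ d)
      interchange = ℕ-Solver.solve-∀
      additive : ∀ e f → degIn₂ v w (e ⊕ f) ≡ degIn₂ v w e ℕ.+ degIn₂ v w f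
      additive e f = trans (cong₂ ℕ._+_ (VecP.lookup-zipWith ℕ._+_ v e f) (VecP.lookup-zipWith ℕ._+_ w e f))
                           (interchange (lookup e v) (lookup f v) (lookup e w) (lookup f w))

  Deg-*P : ∀ {φ} → Additive φ → ∀ {d₁ d₂} p q → Deg φ d₁ p → Deg φ d₂ q → Deg φ (d₁ ℕ.+ d₂) (p *P q)
  Deg-*P add [] q [] dq = []
  Deg-*P {φ} add {d₁} {d₂} ((c , e) ∷ p) q (de ∷ dp) dq = terms q dq
    where
      terms : ∀ r → Deg φ d₂ r → Deg φ (d₁ ℕ.+ d₂) (map (λ { (d , f) → (c * d , e ⊕ f) }) r ++ p *P q)
      terms [] [] = Deg-*P add p q dp dq
      terms ((d , f) ∷ r) (df ∷ dr) = trans (proj₁ add e f) (cong₂ ℕ._+_ de df) ∷ terms r dr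

  Deg-^ : ∀ {φ} → Additive φ → ∀ {d} p n → Deg φ d p → Deg φ (n ℕ.* d) (p ^P n)
  Deg-^ add p zero dp = proj₂ add ∷ []
  Deg-^ add p (suc n) dp = Deg-*P add p (p ^P n) dp (Deg-^ add p n dp)

  Deg-^-0 : ∀ {φ} → Additive φ → ∀ p n → Deg φ 0 p → Deg φ 0 (p ^P n)
  Deg-^-0 {φ} add p n dp = subst (λ d → Deg φ d (p ^P n)) (ℕP.*-zeroʳ n) (Deg-^ add p n dp)

  Deg-^-1 : ∀ {φ} → Additive φ → ∀ p n → Deg φ 1 p → Deg φ n (p ^P n)
  Deg-^-1 {φ} add p n dp = subst (λ d → Deg φ d (p ^P n)) (ℕP.*-identityʳ n) (Deg-^ add p n dp)

  L-on-support : ∀ {P : Exps → Set} {h k : Exps → ℚ} p → All (λ t → P (proj₂ t)) p →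
                 (∀ e → P e → h e ≡ k e) → L h p ≡ L k p
  L-on-support [] [] eq = refl
  L-on-support ((c , e) ∷ p) (pe ∷ ps) eq = cong₂ (λ a b → c * a + b) (eq e pe) (L-on-support p ps eq)

  ∂-free : ∀ v p → Deg (degIn v) 0 p → ∂ v p ≈ []
  ∂-free v p dp = ≈-by (λ h → trans (L-∂ h v p) (trans (L-on-support p dp (λ e eq →
    trans (cong (λ n → ι n * h (lower v e)) eq) (ℚP.*-zeroˡ (h (lower v e))))) (L-0 p)))

  Deg-∂ : ∀ v w p → Deg (degIn v) 0 p → Deg (degIn v) 0 (∂ w p)
  Deg-∂ v w [] [] = []
  Deg-∂ v w ((c , e) ∷ p) (de ∷ dp) = free-after-lower e w v de ∷ Deg-∂ v w p dp
    where
      free-after-lower : ∀ {n} (e : Vec ℕ n) w v → lookup e v ≡ 0 → lookup (updateAt e w ℕ.pred) v ≡ 0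
      free-after-lower (x ∷ e) zero zero eq = cong ℕ.pred eq
      free-after-lower (x ∷ e) zero (suc v) eq = eq
      free-after-lower (x ∷ e) (suc w) zero eq = eq
      free-after-lower (x ∷ e) (suc w) (suc v) eq = free-after-lower e w v eq

  -- Euler's identity: v ∂/∂v multiplies each monomial by its exponent of v, so
  -- (v ∂/∂v + w ∂/∂w) p = d · p when p is homogeneous of degree d in v, w.
  L-var-∂ : ∀ h v p → L h (var v *P ∂ v p) ≡ L (λ g → ι (lookup g v) * h g) p
  L-var-∂ h v p = begin
      L h (var v *P ∂ v p)
    ≡⟨ trans (L-*P h (var v) (∂ v p)) (trans (ℚP.+-identityʳ _) (ℚP.*-identityˡ _)) ⟩
      L (λ f → h (unit v ⊕ f)) (∂ v p)
    ≡⟨ L-∂ _ v p ⟩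
      L (λ g → ι (lookup g v) * h (unit v ⊕ lower v g)) p
    ≡⟨ L-cong (λ g → ι-*-guard (lookup g v) (λ eq → cong h (raise-lower v g eq))) p ⟩
      L (λ g → ι (lookup g v) * h g) p ∎
    where
      open ≡-Reasoning
      raise-lower : ∀ {n} (v : Fin n) (g : Vec ℕ n) {k} → lookup g v ≡ suc k →
                    zipWith ℕ._+_ (updateAt (replicate n 0) v suc) (updateAt g v ℕ.pred) ≡ g
      raise-lower zero (x ∷ g) eq =
        cong₂ _∷_ (trans (cong (λ m → ℕ.suc (ℕ.pred m)) eq) (sym eq)) (VecP.zipWith-identityˡ ℕP.+-identityˡ g)
      raise-lower (suc v) (x ∷ g) eq = cong (x ∷_) (raise-lower v g eq)

  euler : ∀ v w d p → Deg (degIn₂ v w) d p → var v *P ∂ v p +P var w *P ∂ w p ≈ ⌜ d ⌝ *P p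
  euler v w d p dp = ≈-by (λ h → begin
      L h (var v *P ∂ v p +P var w *P ∂ w p)
    ≡⟨ trans (L-++ h (var v *P ∂ v p) (var w *P ∂ w p)) (cong₂ _+_ (L-var-∂ h v p) (L-var-∂ h w p)) ⟩
      L (λ g → ι (lookup g v) * h g) p + L (λ g → ι (lookup g w) * h g) p
    ≡⟨ sym (L-+ _ _ p) ⟩
      L (λ g → ι (lookup g v) * h g + ι (lookup g w) * h g) p
    ≡⟨ L-on-support p dp (λ g eq → trans (sym (ℚP.*-distribʳ-+ (h g) (ι (lookup g v)) (ι (lookup g w))))
                                         (cong (_* h g) (trans (sym (ι-+ (lookup g v) (lookup g w))) (cong ι eq)))) ⟩
      L (λ g → ι d * h g) p
    ≡⟨ trans (L-* (ι d) h p) (sym (L-cst-*P h (ι d) p)) ⟩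
      L h (⌜ d ⌝ *P p) ∎)
    where open ≡-Reasoning

  coeff : ℕ → ℕ → ℚ
  coeff κ i = (+ (i ! ℕ.* (κ ℕ.∸ i) !) / κ !) {{κ !≢0}}

  pair₁-yes : ∀ κ i b j b′ → i ℕ.+ b ≡ κ → j ℕ.+ b′ ≡ κ → i ℕ.+ j ≡ κ → pair₁ κ i b j b′ ≡ sgn i * coeff κ i
  pair₁-yes κ i b j b′ e₁ e₂ e₃ with i ℕ.+ b ≟ κ | j ℕ.+ b′ ≟ κ | i ℕ.+ j ≟ κ
  ... | yes _ | yes _ | yes _ = refl
  ... | no ¬e₁ | _ | _ = contradiction e₁ ¬e₁
  ... | yes _ | no ¬e₂ | _ = contradiction e₂ ¬e₂
  ... | yes _ | yes _ | no ¬e₃ = contradiction e₃ ¬e₃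

  pair₁-no : ∀ κ i b j b′ → ¬ (i ℕ.+ b ≡ κ × j ℕ.+ b′ ≡ κ × i ℕ.+ j ≡ κ) → pair₁ κ i b j b′ ≡ 0ℚ
  pair₁-no κ i b j b′ ¬conds with i ℕ.+ b ≟ κ | j ℕ.+ b′ ≟ κ | i ℕ.+ j ≟ κ
  ... | yes e₁ | yes e₂ | yes e₃ = contradiction (e₁ , e₂ , e₃) ¬conds
  ... | no _ | _ | _ = refl
  ... | yes _ | no _ | _ = refl
  ... | yes _ | yes _ | no _ = refl

  coeff-step : ∀ k m N → inv k * (ι m * (+ N / k !) {{k !≢0}}) ≡ (+ (m ℕ.* N) / suc k !) {{suc k !≢0}}
  coeff-step k m N = trans (cong (inv k *_) (ι-/ m N (k !) {{k !≢0}})) (inv-/ k (m ℕ.* N) (k !) {{k !≢0}})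

  coeff-X : ∀ a b → coeff (suc (a ℕ.+ b)) (suc a) ≡ inv (a ℕ.+ b) * (ι (suc a) * coeff (a ℕ.+ b) a)
  coeff-X a b = trans (cong (λ n → (+ n / suc (a ℕ.+ b) !) {{suc (a ℕ.+ b) !≢0}}) (ℕP.*-assoc (suc a) (a !) _))
                      (sym (coeff-step (a ℕ.+ b) (suc a) (a ! ℕ.* (a ℕ.+ b ℕ.∸ a) !)))

  coeff-Y : ∀ a b → coeff (suc (a ℕ.+ b)) a ≡ inv (a ℕ.+ b) * (ι (suc b) * coeff (a ℕ.+ b) a)
  coeff-Y a b = begin
      coeff (suc k) a
    ≡⟨ cong (λ n → (+ (a ! ℕ.* n !) / suc k !) {{suc k !≢0}})
            (trans (cong (ℕ._∸ a) (sym (ℕP.+-suc a b))) (ℕP.m+n∸m≡n a (suc b))) ⟩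
      (+ (a ! ℕ.* (suc b ℕ.* b !)) / suc k !) {{suc k !≢0}}
    ≡⟨ cong (λ n → (+ n / suc k !) {{suc k !≢0}}) (swap (a !) (suc b) (b !)) ⟩
      (+ (suc b ℕ.* (a ! ℕ.* b !)) / suc k !) {{suc k !≢0}}
    ≡⟨ sym (coeff-step k (suc b) (a ! ℕ.* b !)) ⟩
      inv k * (ι (suc b) * (+ (a ! ℕ.* b !) / k !) {{k !≢0}})
    ≡⟨ cong (λ n → inv k * (ι (suc b) * (+ (a ! ℕ.* n !) / k !) {{k !≢0}})) (sym (ℕP.m+n∸m≡n a b)) ⟩
      inv k * (ι (suc b) * coeff k a) ∎
    where
      k = a ℕ.+ b
      open ≡-Reasoning
      swap : ∀ x y z → x ℕ.* (y ℕ.* z) ≡ y ℕ.* (x ℕ.* z)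
      swap = ℕ-Solver.solve-∀

  vanish-exponent : ∀ r x → r * (ι 0 * x) ≡ 0ℚ
  vanish-exponent r x = trans (cong (r *_) (ℚP.*-zeroˡ x)) (ℚP.*-zeroʳ r)

  vanish-pairing : ∀ r n {x} → x ≡ 0ℚ → r * (ι n * x) ≡ 0ℚ
  vanish-pairing r n refl = trans (cong (r *_) (ℚP.*-zeroʳ (ι n))) (ℚP.*-zeroʳ r)

  pair₁-X : ∀ k a b c d → pair₁ (suc k) (suc a) b c d ≡ (- inv k) * (ι d * pair₁ k a b c (ℕ.pred d))
  pair₁-X k a b c zero =
    trans (pair₁-no (suc k) (suc a) b c 0 impossible) (sym (vanish-exponent (- inv k) (pair₁ k a b c 0)))
    where
      impossible : ¬ (suc a ℕ.+ b ≡ suc k × c ℕ.+ 0 ≡ suc k × suc a ℕ.+ c ≡ suc k)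
      impossible (_ , e₂ , e₃) =
        ℕP.m+1+n≢n a (trans (cong (a ℕ.+_) (trans (sym e₂) (ℕP.+-identityʳ c))) (ℕP.suc-injective e₃))
  pair₁-X k a b c (suc d) with (a ℕ.+ b ≟ k) ×-dec (c ℕ.+ d ≟ k) ×-dec (a ℕ.+ c ≟ k)
  ... | no ¬conds = trans (pair₁-no (suc k) (suc a) b c (suc d) shifted)
                          (sym (vanish-pairing (- inv k) (suc d) (pair₁-no k a b c d ¬conds)))
    where
      shifted : ¬ (suc a ℕ.+ b ≡ suc k × c ℕ.+ suc d ≡ suc k × suc a ℕ.+ c ≡ suc k)
      shifted (e₁ , e₂ , e₃) =
        ¬conds (ℕP.suc-injective e₁ , ℕP.suc-injective (trans (sym (ℕP.+-suc c d)) e₂) , ℕP.suc-injective e₃)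
  ... | yes (refl , e₂ , e₃) = begin
      pair₁ (suc k) (suc a) b c (suc d)
    ≡⟨ pair₁-yes (suc k) (suc a) b c (suc d) refl (trans (ℕP.+-suc c d) (cong suc e₂)) (cong suc e₃) ⟩
      - sgn a * coeff (suc k) (suc a)
    ≡⟨ cong (- sgn a *_) (coeff-X a b) ⟩
      - sgn a * (inv k * (ι (suc a) * coeff k a))
    ≡⟨ rearrange (sgn a) (inv k) (ι (suc a)) (coeff k a) ⟩
      (- inv k) * (ι (suc a) * (sgn a * coeff k a))
    ≡⟨ cong (λ n → (- inv k) * (ι (suc n) * (sgn a * coeff k a))) (sym d≡a) ⟩
      (- inv k) * (ι (suc d) * (sgn a * coeff k a))
    ≡⟨ cong (λ x → (- inv k) * (ι (suc d) * x)) (sym (pair₁-yes k a b c d refl e₂ e₃)) ⟩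
      (- inv k) * (ι (suc d) * pair₁ k a b c d) ∎
    where
      open ≡-Reasoning
      d≡a : d ≡ a
      d≡a = ℕP.+-cancelˡ-≡ c d a (trans e₂ (trans (sym e₃) (ℕP.+-comm a c)))
      rearrange : ∀ s i n x → - s * (i * (n * x)) ≡ (- i) * (n * (s * x))
      rearrange = solve-∀ ℚ-ring

  pair₁-Y : ∀ k a b c d → pair₁ (suc k) a (suc b) c d ≡ inv k * (ι c * pair₁ k a b (ℕ.pred c) d)
  pair₁-Y k a b zero d =
    trans (pair₁-no (suc k) a (suc b) 0 d impossible) (sym (vanish-exponent (inv k) (pair₁ k a b 0 d)))
    where
      impossible : ¬ (a ℕ.+ suc b ≡ suc k × 0 ℕ.+ d ≡ suc k × a ℕ.+ 0 ≡ suc k)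
      impossible (e₁ , _ , e₃) =
        ℕP.m+1+n≢m (suc k) (trans (cong (ℕ._+ suc b) (trans (sym e₃) (ℕP.+-identityʳ a))) e₁)
  pair₁-Y k a b (suc c) d with (a ℕ.+ b ≟ k) ×-dec (c ℕ.+ d ≟ k) ×-dec (a ℕ.+ c ≟ k)
  ... | no ¬conds = trans (pair₁-no (suc k) a (suc b) (suc c) d shifted)
                          (sym (vanish-pairing (inv k) (suc c) (pair₁-no k a b c d ¬conds)))
    where
      shifted : ¬ (a ℕ.+ suc b ≡ suc k × suc c ℕ.+ d ≡ suc k × a ℕ.+ suc c ≡ suc k)
      shifted (e₁ , e₂ , e₃) = ¬conds (ℕP.suc-injective (trans (sym (ℕP.+-suc a b)) e₁) ,
                                       ℕP.suc-injective e₂ , ℕP.suc-injective (trans (sym (ℕP.+-suc a c)) e₃))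
  ... | yes (refl , e₂ , e₃) = begin
      pair₁ (suc k) a (suc b) (suc c) d
    ≡⟨ pair₁-yes (suc k) a (suc b) (suc c) d (ℕP.+-suc a b) (cong suc e₂) (trans (ℕP.+-suc a c) (cong suc e₃)) ⟩
      sgn a * coeff (suc k) a
    ≡⟨ cong (sgn a *_) (coeff-Y a b) ⟩
      sgn a * (inv k * (ι (suc b) * coeff k a))
    ≡⟨ rearrange (sgn a) (inv k) (ι (suc b)) (coeff k a) ⟩
      inv k * (ι (suc b) * (sgn a * coeff k a))
    ≡⟨ cong (λ n → inv k * (ι (suc n) * (sgn a * coeff k a))) (sym c≡b) ⟩
      inv k * (ι (suc c) * (sgn a * coeff k a))
    ≡⟨ cong (λ x → inv k * (ι (suc c) * x)) (sym (pair₁-yes k a b c d refl e₂ e₃)) ⟩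
      inv k * (ι (suc c) * pair₁ k a b c d) ∎
    where
      open ≡-Reasoning
      c≡b : c ≡ b
      c≡b = ℕP.+-cancelˡ-≡ a c b e₃
      rearrange : ∀ s i n x → s * (i * (n * x)) ≡ i * (n * (s * x))
      rearrange = solve-∀ ℚ-ring

  sumℚ-++ : ∀ xs ys → sumℚ (xs ++ ys) ≡ sumℚ xs + sumℚ ys
  sumℚ-++ [] ys = sym (ℚP.+-identityˡ _)
  sumℚ-++ (x ∷ xs) ys = trans (cong (λ z → x + z) (sumℚ-++ xs ys)) (sym (ℚP.+-assoc x (sumℚ xs) (sumℚ ys)))

  pairing-L : ∀ κ₁ κ₂ κ₃ p q → pairing κ₁ κ₂ κ₃ p q ≡ L (λ e → L (pairMono κ₁ κ₂ κ₃ e) q) p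
  pairing-L κ₁ κ₂ κ₃ [] q = refl
  pairing-L κ₁ κ₂ κ₃ ((c , e) ∷ p) q =
    trans (sumℚ-++ (map _ q) _) (cong₂ _+_ (row _ (λ d f → refl) q) (pairing-L κ₁ κ₂ κ₃ p q))
    where
      row : ∀ (G : ℚ × Exps → ℚ) → (∀ d f → G (d , f) ≡ c * d * pairMono κ₁ κ₂ κ₃ e f) →
            ∀ q → sumℚ (map G q) ≡ c * L (pairMono κ₁ κ₂ κ₃ e) q
      row G eq [] = sym (ℚP.*-zeroʳ c)
      row G eq ((d , f) ∷ q) = trans (cong₂ _+_ (eq d f) (row G eq q)) (factor c d (pairMono κ₁ κ₂ κ₃ e f) _)
        where
          factor : ∀ c d a x → c * d * a + c * x ≡ c * (d * a + x)
          factor = solve-∀ ℚ-ring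

  record Bilinear (B : Poly → Poly → ℚ) : Set where
    field
      congˡ : ∀ {p p′} q → p ≈ p′ → B p q ≡ B p′ q
      congʳ : ∀ p {q q′} → q ≈ q′ → B p q ≡ B p q′
      +ˡ : ∀ p p′ q → B (p +P p′) q ≡ B p q + B p′ q
      negˡ : ∀ p q → B (negP p) q ≡ - B p q
      -ʳ : ∀ p q q′ → B p (q -P q′) ≡ B p q + - B p q′
      cstʳ : ∀ p r q → B p (cst r *P q) ≡ r * B p q

  pairing-bilinear : ∀ κ₁ κ₂ κ₃ → Bilinear (pairing κ₁ κ₂ κ₃)
  pairing-bilinear κ₁ κ₂ κ₃ = record
    { congˡ = λ {p} {p′} q p≈p′ → via-L p q (trans (L-≈ p≈p′ _) (sym (pairing-L κ₁ κ₂ κ₃ p′ q)))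
    ; congʳ = λ p {q} {q′} q≈q′ → via-L p q (trans (L-cong (λ e → L-≈ q≈q′ _) p) (sym (pairing-L κ₁ κ₂ κ₃ p q′)))
    ; +ˡ = λ p p′ q → via-L (p +P p′) q
             (trans (L-++ _ p p′) (cong₂ _+_ (sym (pairing-L κ₁ κ₂ κ₃ p q)) (sym (pairing-L κ₁ κ₂ κ₃ p′ q))))
    ; negˡ = λ p q → via-L (negP p) q (trans (L-neg _ p) (cong -_ (sym (pairing-L κ₁ κ₂ κ₃ p q))))
    ; -ʳ = λ p q q′ → via-L p (q -P q′) (begin
        L (λ e → L (K e) (q ++ negP q′)) p
      ≡⟨ L-cong (λ e → trans (L-++ _ q (negP q′)) (cong (λ z → L (K e) q + z) (L-neg _ q′))) p ⟩
        L (λ e → L (K e) q + - L (K e) q′) p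
      ≡⟨ trans (L-+ _ _ p) (cong (λ z → L (λ e → L (K e) q) p + z) (L-- _ p)) ⟩
        L (λ e → L (K e) q) p + - L (λ e → L (K e) q′) p
      ≡⟨ cong₂ (λ x y → x + - y) (sym (pairing-L κ₁ κ₂ κ₃ p q)) (sym (pairing-L κ₁ κ₂ κ₃ p q′)) ⟩
        pairing κ₁ κ₂ κ₃ p q + - pairing κ₁ κ₂ κ₃ p q′ ∎)
    ; cstʳ = λ p r q → via-L p (cst r *P q) (trans (L-cong (λ e → L-cst-*P _ r q) p)
                                (trans (L-* r _ p) (cong (r *_) (sym (pairing-L κ₁ κ₂ κ₃ p q)))))
    }
    where
      open ≡-Reasoning
      K = pairMono κ₁ κ₂ κ₃
      via-L : ∀ p q {x} → L (λ e → L (K e) q) p ≡ x → pairing κ₁ κ₂ κ₃ p q ≡ x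
      via-L p q = trans (pairing-L κ₁ κ₂ κ₃ p q)

  adjoint-var : ∀ {κ₁ κ₂ κ₃ κ₁′ κ₂′ κ₃′} v w r →
    (∀ f g → pairMono κ₁ κ₂ κ₃ (unit v ⊕ f) g ≡ r * (ι (lookup g w) * pairMono κ₁′ κ₂′ κ₃′ f (lower w g))) →
    ∀ p q → pairing κ₁ κ₂ κ₃ (var v *P p) q ≡ r * pairing κ₁′ κ₂′ κ₃′ p (∂ w q)
  adjoint-var {κ₁} {κ₂} {κ₃} {κ₁′} {κ₂′} {κ₃′} v w r pointwise p q = begin
      pairing κ₁ κ₂ κ₃ (var v *P p) q
    ≡⟨ trans (pairing-L κ₁ κ₂ κ₃ (var v *P p) q) (L-*P _ (var v) p) ⟩
      1ℚ * L (λ f → L (pairMono κ₁ κ₂ κ₃ (unit v ⊕ f)) q) p + 0ℚ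
    ≡⟨ trans (ℚP.+-identityʳ _) (ℚP.*-identityˡ _) ⟩
      L (λ f → L (pairMono κ₁ κ₂ κ₃ (unit v ⊕ f)) q) p
    ≡⟨ L-cong (λ f → trans (L-cong (pointwise f) q) (trans (L-* r _ q) (cong (r *_) (sym (L-∂ _ w q))))) p ⟩
      L (λ f → r * L (pairMono κ₁′ κ₂′ κ₃′ f) (∂ w q)) p
    ≡⟨ trans (L-* r _ p) (cong (r *_) (sym (pairing-L κ₁′ κ₂′ κ₃′ p (∂ w q)))) ⟩
      r * pairing κ₁′ κ₂′ κ₃′ p (∂ w q) ∎
    where open ≡-Reasoning

  iX₁ iY₁ iX₂ iY₂ iX₃ iY₃ : Fin 6
  iX₁ = zero
  iY₁ = suc zero
  iX₂ = suc (suc zero)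
  iY₂ = suc (suc (suc zero))
  iX₃ = suc (suc (suc (suc zero)))
  iY₃ = suc (suc (suc (suc (suc zero))))

  -- The monomial pairing is a product of three one-variable pairings, so a
  -- rescaling of one factor rescales the product.
  slot₁ : ∀ {x x′} r n y z → x ≡ r * (n * x′) → x * y * z ≡ r * (n * (x′ * y * z))
  slot₁ {x′ = x′} r n y z refl = rearrange r n x′ y z
    where
      rearrange : ∀ r n x y z → r * (n * x) * y * z ≡ r * (n * (x * y * z))
      rearrange = solve-∀ ℚ-ring

  slot₂ : ∀ {y y′} r n x z → y ≡ r * (n * y′) → x * y * z ≡ r * (n * (x * y′ * z))
  slot₂ {y′ = y′} r n x z refl = rearrange r n x y′ z
    where
      rearrange : ∀ r n x y z → x * (r * (n * y)) * z ≡ r * (n * (x * y * z))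
      rearrange = solve-∀ ℚ-ring

  slot₃ : ∀ {z z′} r n x y → z ≡ r * (n * z′) → x * y * z ≡ r * (n * (x * y * z′))
  slot₃ {z′ = z′} r n x y refl = rearrange r n x y z′
    where
      rearrange : ∀ r n x y z → x * y * (r * (n * z)) ≡ r * (n * (x * y * z))
      rearrange = solve-∀ ℚ-ring

  adjoint-X₁ : ∀ k κ₂ κ₃ p q → pairing (suc k) κ₂ κ₃ (X₁ *P p) q ≡ (- inv k) * pairing k κ₂ κ₃ p (∂ iY₁ q)
  adjoint-X₁ k κ₂ κ₃ = adjoint-var iX₁ iY₁ (- inv k) λ where
    (a₁ ∷ b₁ ∷ a₂ ∷ b₂ ∷ a₃ ∷ b₃ ∷ []) (c₁ ∷ d₁ ∷ c₂ ∷ d₂ ∷ c₃ ∷ d₃ ∷ []) →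
      slot₁ (- inv k) (ι d₁) (pair₁ κ₂ a₂ b₂ c₂ d₂) (pair₁ κ₃ a₃ b₃ c₃ d₃) (pair₁-X k a₁ b₁ c₁ d₁)

  adjoint-Y₁ : ∀ k κ₂ κ₃ p q → pairing (suc k) κ₂ κ₃ (Y₁ *P p) q ≡ inv k * pairing k κ₂ κ₃ p (∂ iX₁ q)
  adjoint-Y₁ k κ₂ κ₃ = adjoint-var iY₁ iX₁ (inv k) λ where
    (a₁ ∷ b₁ ∷ a₂ ∷ b₂ ∷ a₃ ∷ b₃ ∷ []) (c₁ ∷ d₁ ∷ c₂ ∷ d₂ ∷ c₃ ∷ d₃ ∷ []) →
      slot₁ (inv k) (ι c₁) (pair₁ κ₂ a₂ b₂ c₂ d₂) (pair₁ κ₃ a₃ b₃ c₃ d₃) (pair₁-Y k a₁ b₁ c₁ d₁)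

  adjoint-X₂ : ∀ κ₁ k κ₃ p q → pairing κ₁ (suc k) κ₃ (X₂ *P p) q ≡ (- inv k) * pairing κ₁ k κ₃ p (∂ iY₂ q)
  adjoint-X₂ κ₁ k κ₃ = adjoint-var iX₂ iY₂ (- inv k) λ where
    (a₁ ∷ b₁ ∷ a₂ ∷ b₂ ∷ a₃ ∷ b₃ ∷ []) (c₁ ∷ d₁ ∷ c₂ ∷ d₂ ∷ c₃ ∷ d₃ ∷ []) →
      slot₂ (- inv k) (ι d₂) (pair₁ κ₁ a₁ b₁ c₁ d₁) (pair₁ κ₃ a₃ b₃ c₃ d₃) (pair₁-X k a₂ b₂ c₂ d₂)

  adjoint-Y₂ : ∀ κ₁ k κ₃ p q → pairing κ₁ (suc k) κ₃ (Y₂ *P p) q ≡ inv k * pairing κ₁ k κ₃ p (∂ iX₂ q)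
  adjoint-Y₂ κ₁ k κ₃ = adjoint-var iY₂ iX₂ (inv k) λ where
    (a₁ ∷ b₁ ∷ a₂ ∷ b₂ ∷ a₃ ∷ b₃ ∷ []) (c₁ ∷ d₁ ∷ c₂ ∷ d₂ ∷ c₃ ∷ d₃ ∷ []) →
      slot₂ (inv k) (ι c₂) (pair₁ κ₁ a₁ b₁ c₁ d₁) (pair₁ κ₃ a₃ b₃ c₃ d₃) (pair₁-Y k a₂ b₂ c₂ d₂)

  adjoint-X₃ : ∀ κ₁ κ₂ k p q → pairing κ₁ κ₂ (suc k) (X₃ *P p) q ≡ (- inv k) * pairing κ₁ κ₂ k p (∂ iY₃ q)
  adjoint-X₃ κ₁ κ₂ k = adjoint-var iX₃ iY₃ (- inv k) λ where
    (a₁ ∷ b₁ ∷ a₂ ∷ b₂ ∷ a₃ ∷ b₃ ∷ []) (c₁ ∷ d₁ ∷ c₂ ∷ d₂ ∷ c₃ ∷ d₃ ∷ []) →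
      slot₃ (- inv k) (ι d₃) (pair₁ κ₁ a₁ b₁ c₁ d₁) (pair₁ κ₂ a₂ b₂ c₂ d₂) (pair₁-X k a₃ b₃ c₃ d₃)

  adjoint-Y₃ : ∀ κ₁ κ₂ k p q → pairing κ₁ κ₂ (suc k) (Y₃ *P p) q ≡ inv k * pairing κ₁ κ₂ k p (∂ iX₃ q)
  adjoint-Y₃ κ₁ κ₂ k = adjoint-var iY₃ iX₃ (inv k) λ where
    (a₁ ∷ b₁ ∷ a₂ ∷ b₂ ∷ a₃ ∷ b₃ ∷ []) (c₁ ∷ d₁ ∷ c₂ ∷ d₂ ∷ c₃ ∷ d₃ ∷ []) →
      slot₃ (inv k) (ι c₃) (pair₁ κ₁ a₁ b₁ c₁ d₁) (pair₁ κ₂ a₂ b₂ c₂ d₂) (pair₁-Y k a₃ b₃ c₃ d₃)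

  bracket : Fin 6 → Fin 6 → Fin 6 → Fin 6 → Poly
  bracket x w u y = var x *P var w -P var u *P var y

  Ω : Fin 6 → Fin 6 → Fin 6 → Fin 6 → Poly → Poly
  Ω x w u y g = ∂ x (∂ w g) -P ∂ u (∂ y g)

  bracket-adjoint : ∀ {B B₁ B₂ B′ : Poly → Poly → ℚ} → Bilinear B → Bilinear B′ → ∀ (x w u y : Fin 6) (α β : ℚ) →
    (∀ p q → B (var x *P p) q ≡ (- α) * B₁ p (∂ y q)) →
    (∀ p q → B₁ (var w *P p) q ≡ β * B′ p (∂ u q)) →
    (∀ p q → B (var u *P p) q ≡ (- β) * B₂ p (∂ w q)) →
    (∀ p q → B₂ (var y *P p) q ≡ α * B′ p (∂ x q)) →
    ∀ f g → B (bracket x w u y *P f) g ≡ α * β * B′ f (Ω x w u y g)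
  bracket-adjoint {B} {B₁} {B₂} {B′} bil bil′ x w u y α β adj-x adj-w adj-u adj-y f g = begin
      B (bracket x w u y *P f) g
    ≡⟨ congˡ g (expand (var x) (var w) (var u) (var y) f) ⟩
      B (var x *P (var w *P f) +P negP (var u *P (var y *P f))) g
    ≡⟨ trans (+ˡ (var x *P (var w *P f)) _ g)
             (cong (λ z → B (var x *P (var w *P f)) g + z) (negˡ (var u *P (var y *P f)) g)) ⟩
      B (var x *P (var w *P f)) g + - B (var u *P (var y *P f)) g
    ≡⟨ cong₂ (λ s t → s + - t) (trans (adj-x (var w *P f) g) (cong ((- α) *_) (adj-w f (∂ y g))))
                              (trans (adj-u (var y *P f) g) (cong ((- β) *_) (adj-y f (∂ w g)))) ⟩
      (- α) * (β * B′ f (∂ u (∂ y g))) + - ((- β) * (α * B′ f (∂ x (∂ w g))))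
    ≡⟨ collect α β (B′ f (∂ u (∂ y g))) (B′ f (∂ x (∂ w g))) ⟩
      α * β * (B′ f (∂ x (∂ w g)) + - B′ f (∂ u (∂ y g)))
    ≡⟨ cong (α * β *_) (sym (Bilinear.-ʳ bil′ f _ _)) ⟩
      α * β * B′ f (Ω x w u y g) ∎
    where
      open ≡-Reasoning
      open Bilinear bil
      expand : ∀ x w u y f → (x *P w -P u *P y) *P f ≈ x *P (w *P f) +P negP (u *P (y *P f))
      expand = solve-∀ polyRing
      collect : ∀ a b s t → (- a) * (b * s) + - ((- b) * (a * t)) ≡ a * b * (t + - s)
      collect = solve-∀ ℚ-ring

  A B C : Poly
  A = bracket iX₁ iY₂ iX₂ iY₁
  B = bracket iX₃ iY₁ iX₁ iY₃
  C = bracket iX₃ iY₂ iX₂ iY₃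

  adjoint-A : ∀ k₁ k₂ κ₃ f g →
    pairing (suc k₁) (suc k₂) κ₃ (A *P f) g ≡ inv k₁ * inv k₂ * pairing k₁ k₂ κ₃ f (Ω iX₁ iY₂ iX₂ iY₁ g)
  adjoint-A k₁ k₂ κ₃ = bracket-adjoint {B₁ = pairing k₁ (suc k₂) κ₃} {B₂ = pairing (suc k₁) k₂ κ₃}
    (pairing-bilinear (suc k₁) (suc k₂) κ₃) (pairing-bilinear k₁ k₂ κ₃) iX₁ iY₂ iX₂ iY₁ (inv k₁) (inv k₂)
    (adjoint-X₁ k₁ (suc k₂) κ₃) (adjoint-Y₂ k₁ k₂ κ₃) (adjoint-X₂ (suc k₁) k₂ κ₃) (adjoint-Y₁ k₁ k₂ κ₃)

  adjoint-B : ∀ k₁ κ₂ k₃ f g →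
    pairing (suc k₁) κ₂ (suc k₃) (B *P f) g ≡ inv k₃ * inv k₁ * pairing k₁ κ₂ k₃ f (Ω iX₃ iY₁ iX₁ iY₃ g)
  adjoint-B k₁ κ₂ k₃ = bracket-adjoint {B₁ = pairing (suc k₁) κ₂ k₃} {B₂ = pairing k₁ κ₂ (suc k₃)}
    (pairing-bilinear (suc k₁) κ₂ (suc k₃)) (pairing-bilinear k₁ κ₂ k₃) iX₃ iY₁ iX₁ iY₃ (inv k₃) (inv k₁)
    (adjoint-X₃ (suc k₁) κ₂ k₃) (adjoint-Y₁ k₁ κ₂ k₃) (adjoint-X₁ k₁ κ₂ (suc k₃)) (adjoint-Y₃ k₁ κ₂ k₃)

  adjoint-C : ∀ κ₁ k₂ k₃ f g →
    pairing κ₁ (suc k₂) (suc k₃) (C *P f) g ≡ inv k₃ * inv k₂ * pairing κ₁ k₂ k₃ f (Ω iX₃ iY₂ iX₂ iY₃ g)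
  adjoint-C κ₁ k₂ k₃ = bracket-adjoint {B₁ = pairing κ₁ (suc k₂) k₃} {B₂ = pairing κ₁ k₂ (suc k₃)}
    (pairing-bilinear κ₁ (suc k₂) (suc k₃)) (pairing-bilinear κ₁ k₂ k₃) iX₃ iY₂ iX₂ iY₃ (inv k₃) (inv k₂)
    (adjoint-X₃ κ₁ (suc k₂) k₃) (adjoint-Y₂ κ₁ k₂ k₃) (adjoint-X₂ κ₁ k₂ (suc k₃)) (adjoint-Y₃ κ₁ k₂ k₃)

  ∂-*P-by : ∀ v p {p′} q → ∂ v p ≈ p′ → ∂ v (p *P q) ≈ p′ *P q +P p *P ∂ v q
  ∂-*P-by v p q ∂p≈p′ = ≈-trans (leibniz v p q) (+P-cong (*P-cong ∂p≈p′ ≈-refl) ≈-refl)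

  cayley-factor : ℕ → ℕ → ℕ
  cayley-factor n d = suc n ℕ.* (suc (suc n) ℕ.+ d)

  -- (stated with cayley-factor unfolded, for the solver)
  cayley-factor-zero : ∀ dᵢ dⱼ → 2 ℕ.+ (0 ℕ.+ dᵢ) ℕ.+ (0 ℕ.+ dⱼ) ≡ 1 ℕ.* (2 ℕ.+ (dᵢ ℕ.+ dⱼ))
  cayley-factor-zero = ℕ-Solver.solve-∀

  cayley-factor-suc : ∀ m dᵢ dⱼ → 2 ℕ.+ (suc m ℕ.+ dᵢ) ℕ.+ (suc m ℕ.+ dⱼ) ℕ.+ suc m ℕ.* (suc (suc m) ℕ.+ (dᵢ ℕ.+ dⱼ))
                                  ≡ suc (suc m) ℕ.* (suc (suc (suc m)) ℕ.+ (dᵢ ℕ.+ dⱼ))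
  cayley-factor-suc = ℕ-Solver.solve-∀

  module Cayley (ix iw iu iy : Fin 6)
      (x≢w : ix ≢ iw) (x≢u : ix ≢ iu) (x≢y : ix ≢ iy) (w≢u : iw ≢ iu) (w≢y : iw ≢ iy) (u≢y : iu ≢ iy)
      (Q-degree-xy : Deg (degIn₂ ix iy) 1 (bracket ix iw iu iy))
      (Q-degree-uw : Deg (degIn₂ iu iw) 1 (bracket ix iw iu iy)) where

    x w u y Q : Poly
    x = var ix
    w = var iw
    u = var iu
    y = var iy
    Q = bracket ix iw iu iy

    D : Poly → Poly
    D = Ω ix iw iu iy

    D-cong : ∀ {p q} → p ≈ q → D p ≈ D q
    D-cong p≈q = -P-cong (∂-cong ix (∂-cong iw p≈q)) (∂-cong iu (∂-cong iy p≈q))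

    ∂-Q : ∀ v {δx δw δu δy} → ∂ v x ≈ δx → ∂ v w ≈ δw → ∂ v u ≈ δu → ∂ v y ≈ δy →
          ∂ v Q ≈ (δx *P w +P x *P δw) -P (δu *P y +P u *P δy)
    ∂-Q v δx δw δu δy = ≈-trans (∂-+P v (x *P w) (negP (u *P y)))
      (+P-cong (≈-trans (∂-*P-by v x w δx) (+P-congʳ _ (*P-congʳ x δw)))
               (≈-trans (∂-negP v (u *P y)) (negP-cong (≈-trans (∂-*P-by v u y δu) (+P-congʳ _ (*P-congʳ u δy))))))

    ∂x-Q : ∂ ix Q ≈ w
    ∂x-Q = ≈-trans (∂-Q ix (∂-var-self ix) (∂-var-other ix iw x≢w) (∂-var-other ix iu x≢u) (∂-var-other ix iy x≢y))
                   (simplify w x y u)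
      where
        simplify : ∀ w x y u → (one *P w +P x *P []) -P ([] *P y +P u *P []) ≈ w
        simplify = solve-∀ polyRing

    ∂w-Q : ∂ iw Q ≈ x
    ∂w-Q = ≈-trans (∂-Q iw (∂-var-other iw ix (x≢w ∘ sym)) (∂-var-self iw) (∂-var-other iw iu w≢u)
                           (∂-var-other iw iy w≢y))
                   (simplify w x y u)
      where
        simplify : ∀ w x y u → ([] *P w +P x *P one) -P ([] *P y +P u *P []) ≈ x
        simplify = solve-∀ polyRing

    ∂u-Q : ∂ iu Q ≈ negP y
    ∂u-Q = ≈-trans (∂-Q iu (∂-var-other iu ix (x≢u ∘ sym)) (∂-var-other iu iw (w≢u ∘ sym)) (∂-var-self iu)
                           (∂-var-other iu iy u≢y))
                   (simplify w x y u)
      where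
        simplify : ∀ w x y u → ([] *P w +P x *P []) -P (one *P y +P u *P []) ≈ negP y
        simplify = solve-∀ polyRing

    ∂y-Q : ∂ iy Q ≈ negP u
    ∂y-Q = ≈-trans (∂-Q iy (∂-var-other iy ix (x≢y ∘ sym)) (∂-var-other iy iw (w≢y ∘ sym))
                           (∂-var-other iy iu (u≢y ∘ sym))
                           (∂-var-self iy))
                   (simplify w x y u)
      where
        simplify : ∀ w x y u → ([] *P w +P x *P []) -P ([] *P y +P u *P one) ≈ negP u
        simplify = solve-∀ polyRing

    Eₓᵧ Eᵤᵥ : Poly → Poly
    Eₓᵧ G = x *P ∂ ix G +P y *P ∂ iy G
    Eᵤᵥ G = u *P ∂ iu G +P w *P ∂ iw G

    Ω-Q-*P : ∀ G → D (Q *P G) ≈ (one +P one) *P G +P (Eₓᵧ G +P Eᵤᵥ G) +P Q *P D G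
    Ω-Q-*P G = ≈-trans (-P-cong ∂x∂w ∂u∂y) (collect G gx gw gu gy (∂ ix gw) (∂ iu gy) Q x w u y)
      where
        gx = ∂ ix G
        gw = ∂ iw G
        gu = ∂ iu G
        gy = ∂ iy G
        ∂x∂w : ∂ ix (∂ iw (Q *P G)) ≈ (one *P G +P x *P gx) +P (w *P gw +P Q *P ∂ ix gw)
        ∂x∂w = ≈-trans (∂-cong ix (∂-*P-by iw Q G ∂w-Q))
                 (≈-trans (∂-+P ix (x *P G) (Q *P gw))
                          (+P-cong (∂-*P-by ix x G (∂-var-self ix)) (∂-*P-by ix Q gw ∂x-Q)))
        ∂u∂y : ∂ iu (∂ iy (Q *P G)) ≈ (negP one *P G +P negP u *P gu) +P (negP y *P gy +P Q *P ∂ iu gy)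
        ∂u∂y = ≈-trans (∂-cong iu (∂-*P-by iy Q G ∂y-Q))
                 (≈-trans (∂-+P iu (negP u *P G) (Q *P gy))
                   (+P-cong (∂-*P-by iu (negP u) G (≈-trans (∂-negP iu u) (negP-cong (∂-var-self iu))))
                            (∂-*P-by iu Q gy ∂u-Q)))
        collect : ∀ G gx gw gu gy gxw guy Q x w u y →
          ((one *P G +P x *P gx) +P (w *P gw +P Q *P gxw))
            -P ((negP one *P G +P negP u *P gu) +P (negP y *P gy +P Q *P guy))
          ≈ (one +P one) *P G +P ((x *P gx +P y *P gy) +P (u *P gu +P w *P gw)) +P Q *P (gxw -P guy)
        collect = solve-∀ polyRing

    module Powers (G : Poly) (dᵢ dⱼ : ℕ) (ΩG≈0 : D G ≈ [])
                  (G-degree-xy : Deg (degIn₂ ix iy) dᵢ G) (G-degree-uw : Deg (degIn₂ iu iw) dⱼ G) where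

      H : ℕ → Poly
      H n = Q ^P n *P G

      -- one application of Ω-Q-*P, with Euler's identity for Q^n G
      Ω-H-suc : ∀ n → D (H (suc n)) ≈ ⌜ 2 ℕ.+ (n ℕ.+ dᵢ) ℕ.+ (n ℕ.+ dⱼ) ⌝ *P H n +P Q *P D (H n)
      Ω-H-suc n = begin
          D (Q *P Q ^P n *P G)
        ≈⟨ D-cong (*P-assoc Q (Q ^P n) G) ⟩
          D (Q *P H n)
        ≈⟨ Ω-Q-*P (H n) ⟩
          (one +P one) *P H n +P (Eₓᵧ (H n) +P Eᵤᵥ (H n)) +P Q *P D (H n)
        ≈⟨ +P-congˡ (Q *P D (H n)) (+P-congʳ ((one +P one) *P H n)
             (+P-cong (euler ix iy _ (H n) degree-xy) (euler iu iw _ (H n) degree-uw))) ⟩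
          (one +P one) *P H n +P (⌜ n ℕ.+ dᵢ ⌝ *P H n +P ⌜ n ℕ.+ dⱼ ⌝ *P H n) +P Q *P D (H n)
        ≈⟨ +P-congˡ (Q *P D (H n)) (collect (H n) ⌜ n ℕ.+ dᵢ ⌝ ⌜ n ℕ.+ dⱼ ⌝) ⟩
          (one +P one +P ⌜ n ℕ.+ dᵢ ⌝ +P ⌜ n ℕ.+ dⱼ ⌝) *P H n +P Q *P D (H n)
        ≈⟨ +P-congˡ (Q *P D (H n)) (*P-congˡ (H n) (≈-sym factor)) ⟩
          ⌜ 2 ℕ.+ (n ℕ.+ dᵢ) ℕ.+ (n ℕ.+ dⱼ) ⌝ *P H n +P Q *P D (H n) ∎
        where
          open SetoidReasoning polySetoid
          degree-xy : Deg (degIn₂ ix iy) (n ℕ.+ dᵢ) (H n)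
          degree-xy = Deg-*P (degIn₂-additive ix iy) (Q ^P n) G
                             (Deg-^-1 (degIn₂-additive ix iy) Q n Q-degree-xy) G-degree-xy
          degree-uw : Deg (degIn₂ iu iw) (n ℕ.+ dⱼ) (H n)
          degree-uw = Deg-*P (degIn₂-additive iu iw) (Q ^P n) G
                             (Deg-^-1 (degIn₂-additive iu iw) Q n Q-degree-uw) G-degree-uw
          collect : ∀ h a b → (one +P one) *P h +P (a *P h +P b *P h) ≈ (one +P one +P a +P b) *P h
          collect = solve-∀ polyRing
          factor : ⌜ 2 ℕ.+ (n ℕ.+ dᵢ) ℕ.+ (n ℕ.+ dⱼ) ⌝ ≈ one +P one +P ⌜ n ℕ.+ dᵢ ⌝ +P ⌜ n ℕ.+ dⱼ ⌝
          factor = ≈-trans (⌜⌝-+ (2 ℕ.+ (n ℕ.+ dᵢ)) (n ℕ.+ dⱼ))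
                           (+P-congˡ _ (≈-trans (⌜⌝-+ 2 (n ℕ.+ dᵢ)) (+P-congˡ _ (⌜⌝-+ 1 1))))

      cayley : ∀ n → D (H (suc n)) ≈ ⌜ cayley-factor n (dᵢ ℕ.+ dⱼ) ⌝ *P H n
      cayley zero = begin
          D (H 1)
        ≈⟨ Ω-H-suc 0 ⟩
          ⌜ 2 ℕ.+ (0 ℕ.+ dᵢ) ℕ.+ (0 ℕ.+ dⱼ) ⌝ *P H 0 +P Q *P D (H 0)
        ≈⟨ +P-congʳ (⌜ 2 ℕ.+ (0 ℕ.+ dᵢ) ℕ.+ (0 ℕ.+ dⱼ) ⌝ *P H 0)
                    (*P-congʳ Q (≈-trans (D-cong (*P-identityˡ G)) ΩG≈0)) ⟩
          ⌜ 2 ℕ.+ (0 ℕ.+ dᵢ) ℕ.+ (0 ℕ.+ dⱼ) ⌝ *P H 0 +P Q *P []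
        ≈⟨ drop-zero (⌜ 2 ℕ.+ (0 ℕ.+ dᵢ) ℕ.+ (0 ℕ.+ dⱼ) ⌝ *P H 0) Q ⟩
          ⌜ 2 ℕ.+ (0 ℕ.+ dᵢ) ℕ.+ (0 ℕ.+ dⱼ) ⌝ *P H 0
        ≡⟨ cong (λ k → ⌜ k ⌝ *P H 0) (cayley-factor-zero dᵢ dⱼ) ⟩
          ⌜ cayley-factor 0 (dᵢ ℕ.+ dⱼ) ⌝ *P H 0 ∎
        where
          open SetoidReasoning polySetoid
          drop-zero : ∀ a q → a +P q *P [] ≈ a
          drop-zero = solve-∀ polyRing
      cayley (suc m) = begin
          D (H (suc n))
        ≈⟨ Ω-H-suc n ⟩
          ⌜ c ⌝ *P H n +P Q *P D (H n)
        ≈⟨ +P-congʳ (⌜ c ⌝ *P H n) (*P-congʳ Q (cayley m)) ⟩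
          ⌜ c ⌝ *P (Q *P Q ^P m *P G) +P Q *P (⌜ cayley-factor m d ⌝ *P (Q ^P m *P G))
        ≈⟨ collect ⌜ c ⌝ ⌜ cayley-factor m d ⌝ Q (Q ^P m) G ⟩
          (⌜ c ⌝ +P ⌜ cayley-factor m d ⌝) *P H n
        ≈⟨ *P-congˡ (H n) (≈-sym (⌜⌝-+ c (cayley-factor m d))) ⟩
          ⌜ c ℕ.+ cayley-factor m d ⌝ *P H n
        ≡⟨ cong (λ k → ⌜ k ⌝ *P H n) (cayley-factor-suc m dᵢ dⱼ) ⟩
          ⌜ cayley-factor n d ⌝ *P H n ∎
        where
          open SetoidReasoning polySetoid
          n = suc m
          d = dᵢ ℕ.+ dⱼ
          c = 2 ℕ.+ (n ℕ.+ dᵢ) ℕ.+ (n ℕ.+ dⱼ)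
          collect : ∀ a b q k g → a *P (q *P k *P g) +P q *P (b *P (k *P g)) ≈ (a +P b) *P (q *P k *P g)
          collect = solve-∀ polyRing

  Ω-free : ∀ x w u y G → Deg (degIn w) 0 G → Deg (degIn u) 0 G → Ω x w u y G ≈ []
  Ω-free x w u y G w-free u-free = -P-cong (∂-cong x (∂-free w G w-free)) (∂-free u (∂ y G) (Deg-∂ u y G u-free))

  Ω-split : ∀ x w u y P₁ P₂ → Deg (degIn w) 0 P₁ → Deg (degIn u) 0 P₁ → Deg (degIn x) 0 P₂ → Deg (degIn y) 0 P₂ →
            Ω x w u y (P₁ *P P₂) ≈ ∂ x P₁ *P ∂ w P₂ -P ∂ y P₁ *P ∂ u P₂
  Ω-split x w u y P₁ P₂ w-free₁ u-free₁ x-free₂ y-free₂ = -P-cong ∂x∂w ∂u∂y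
    where
      drop-left : ∀ p q → [] *P p +P q ≈ q
      drop-left = solve-∀ polyRing
      drop-right : ∀ p q → p +P q *P [] ≈ p
      drop-right = solve-∀ polyRing
      ∂x∂w : ∂ x (∂ w (P₁ *P P₂)) ≈ ∂ x P₁ *P ∂ w P₂
      ∂x∂w = ≈-trans (∂-cong x (≈-trans (∂-*P-by w P₁ P₂ (∂-free w P₁ w-free₁)) (drop-left P₂ (P₁ *P ∂ w P₂))))
               (≈-trans (leibniz x P₁ (∂ w P₂))
                 (≈-trans (+P-congʳ (∂ x P₁ *P ∂ w P₂) (*P-congʳ P₁ (∂-free x (∂ w P₂) (Deg-∂ x w P₂ x-free₂))))
                   (drop-right (∂ x P₁ *P ∂ w P₂) P₁)))
      ∂u∂y : ∂ u (∂ y (P₁ *P P₂)) ≈ ∂ y P₁ *P ∂ u P₂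
      ∂u∂y = ≈-trans (∂-cong u (≈-trans (leibniz y P₁ P₂)
                                 (≈-trans (+P-congʳ (∂ y P₁ *P P₂) (*P-congʳ P₁ (∂-free y P₂ y-free₂)))
                                          (drop-right (∂ y P₁ *P P₂) P₁))))
               (≈-trans (∂-*P-by u (∂ y P₁) P₂ (∂-free u (∂ y P₁) (Deg-∂ u y P₁ u-free₁)))
                        (drop-left P₂ (∂ y P₁ *P ∂ u P₂)))

  module Cayley-A = Cayley iX₁ iY₂ iX₂ iY₁
    (λ ()) (λ ()) (λ ()) (λ ()) (λ ()) (λ ()) (refl ∷ refl ∷ []) (refl ∷ refl ∷ [])
  module Cayley-B = Cayley iX₃ iY₁ iX₁ iY₃
    (λ ()) (λ ()) (λ ()) (λ ()) (λ ()) (λ ()) (refl ∷ refl ∷ []) (refl ∷ refl ∷ [])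
  module Cayley-C = Cayley iX₃ iY₂ iX₂ iY₃
    (λ ()) (λ ()) (λ ()) (λ ()) (λ ()) (λ ()) (refl ∷ refl ∷ []) (refl ∷ refl ∷ [])

  free-^ : ∀ v Q n → Deg (degIn v) 0 Q → Deg (degIn v) 0 (Q ^P n)
  free-^ v = Deg-^-0 (degIn-additive v)

  -- The two mixed terms of Ω_A on B^b C^a agree, so Ω_A (B^b C^a) = 0.
  mixed-terms : ∀ a b → ∂ iX₁ (B ^P b) *P ∂ iY₂ (C ^P a) ≈ ∂ iY₁ (B ^P b) *P ∂ iX₂ (C ^P a)
  mixed-terms a zero =
    ≈-trans (*P-congˡ (∂ iY₂ (C ^P a)) (∂-cst iX₁ 1ℚ)) (≈-sym (*P-congˡ (∂ iX₂ (C ^P a)) (∂-cst iY₁ 1ℚ)))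
  mixed-terms zero (suc b) =
    ≈-trans (≈-trans (*P-congʳ (∂ iX₁ (B ^P suc b)) (∂-cst iY₂ 1ℚ)) (*P-zeroʳ (∂ iX₁ (B ^P suc b))))
            (≈-sym (≈-trans (*P-congʳ (∂ iY₁ (B ^P suc b)) (∂-cst iX₂ 1ℚ)) (*P-zeroʳ (∂ iY₁ (B ^P suc b)))))
  mixed-terms (suc a) (suc b) = begin
      ∂ iX₁ (B ^P suc b) *P ∂ iY₂ (C ^P suc a)
    ≈⟨ *P-cong (∂-^ iX₁ B b) (∂-^ iY₂ C a) ⟩
      (⌜ suc b ⌝ *P B ^P b *P ∂ iX₁ B) *P (⌜ suc a ⌝ *P C ^P a *P ∂ iY₂ C)
    ≈⟨ *P-cong (*P-congʳ (⌜ suc b ⌝ *P B ^P b) Cayley-B.∂u-Q)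
               (*P-congʳ (⌜ suc a ⌝ *P C ^P a) Cayley-C.∂w-Q) ⟩
      (⌜ suc b ⌝ *P B ^P b *P negP Y₃) *P (⌜ suc a ⌝ *P C ^P a *P X₃)
    ≈⟨ exchange ⌜ suc b ⌝ (B ^P b) ⌜ suc a ⌝ (C ^P a) X₃ Y₃ ⟩
      (⌜ suc b ⌝ *P B ^P b *P X₃) *P (⌜ suc a ⌝ *P C ^P a *P negP Y₃)
    ≈⟨ ≈-sym (*P-cong (*P-congʳ (⌜ suc b ⌝ *P B ^P b) Cayley-B.∂w-Q)
                      (*P-congʳ (⌜ suc a ⌝ *P C ^P a) Cayley-C.∂u-Q)) ⟩
      (⌜ suc b ⌝ *P B ^P b *P ∂ iY₁ B) *P (⌜ suc a ⌝ *P C ^P a *P ∂ iX₂ C)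
    ≈⟨ ≈-sym (*P-cong (∂-^ iY₁ B b) (∂-^ iX₂ C a)) ⟩
      ∂ iY₁ (B ^P suc b) *P ∂ iX₂ (C ^P suc a) ∎
    where
      open SetoidReasoning polySetoid
      exchange : ∀ m p n q x y → (m *P p *P negP y) *P (n *P q *P x) ≈ (m *P p *P x) *P (n *P q *P negP y)
      exchange = solve-∀ polyRing

  Ω-A-kills : ∀ a b → Ω iX₁ iY₂ iX₂ iY₁ (B ^P b *P C ^P a) ≈ []
  Ω-A-kills a b = ≈-trans (Ω-split iX₁ iY₂ iX₂ iY₁ (B ^P b) (C ^P a)
                             (free-^ iY₂ B b (refl ∷ refl ∷ [])) (free-^ iX₂ B b (refl ∷ refl ∷ []))
                             (free-^ iX₁ C a (refl ∷ refl ∷ [])) (free-^ iY₁ C a (refl ∷ refl ∷ [])))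
                          (≈-trans (-P-cong (mixed-terms a b) ≈-refl)
                                   (-P-self (∂ iY₁ (B ^P b) *P ∂ iX₂ (C ^P a))))

  Ω-A-step : ∀ a b c → Ω iX₁ iY₂ iX₂ iY₁ (Pκ a b (suc c)) ≈ ⌜ cayley-factor c (b ℕ.+ a) ⌝ *P Pκ a b c
  Ω-A-step a b c = ≈-trans (Cayley-A.D-cong (*P-assoc (A ^P suc c) (B ^P b) (C ^P a)))
                     (≈-trans (Powers.cayley c)
                              (*P-congʳ ⌜ cayley-factor c (b ℕ.+ a) ⌝ (≈-sym (*P-assoc (A ^P c) (B ^P b) (C ^P a)))))
    where
      add₁ = degIn₂-additive iX₁ iY₁
      add₂ = degIn₂-additive iX₂ iY₂
      degree-X₁Y₁ : Deg (degIn₂ iX₁ iY₁) b (B ^P b *P C ^P a)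
      degree-X₁Y₁ = subst (λ d → Deg (degIn₂ iX₁ iY₁) d (B ^P b *P C ^P a)) (ℕP.+-identityʳ b)
        (Deg-*P add₁ (B ^P b) (C ^P a) (Deg-^-1 add₁ B b (refl ∷ refl ∷ [])) (Deg-^-0 add₁ C a (refl ∷ refl ∷ [])))
      degree-X₂Y₂ : Deg (degIn₂ iX₂ iY₂) a (B ^P b *P C ^P a)
      degree-X₂Y₂ =
        Deg-*P add₂ (B ^P b) (C ^P a) (Deg-^-0 add₂ B b (refl ∷ refl ∷ [])) (Deg-^-1 add₂ C a (refl ∷ refl ∷ []))
      module Powers = Cayley-A.Powers (B ^P b *P C ^P a) b a (Ω-A-kills a b) degree-X₁Y₁ degree-X₂Y₂

  Ω-B-step : ∀ a b → Ω iX₃ iY₁ iX₁ iY₃ (Pκ a (suc b) 0) ≈ ⌜ cayley-factor b (a ℕ.+ 0) ⌝ *P Pκ a b 0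
  Ω-B-step a b = ≈-trans (Cayley-B.D-cong (drop-one (B ^P suc b) (C ^P a)))
                   (≈-trans (Powers.cayley b)
                            (*P-congʳ ⌜ cayley-factor b (a ℕ.+ 0) ⌝ (≈-sym (drop-one (B ^P b) (C ^P a)))))
    where
      drop-one : ∀ p q → one *P p *P q ≈ p *P q
      drop-one = solve-∀ polyRing
      module Powers = Cayley-B.Powers (C ^P a) a 0
        (Ω-free iX₃ iY₁ iX₁ iY₃ (C ^P a) (free-^ iY₁ C a (refl ∷ refl ∷ [])) (free-^ iX₁ C a (refl ∷ refl ∷ [])))
        (Deg-^-1 (degIn₂-additive iX₃ iY₃) C a (refl ∷ refl ∷ []))
        (Deg-^-0 (degIn₂-additive iX₁ iY₁) C a (refl ∷ refl ∷ []))

  Ω-C-step : ∀ a → Ω iX₃ iY₂ iX₂ iY₃ (Pκ (suc a) 0 0) ≈ ⌜ cayley-factor a (0 ℕ.+ 0) ⌝ *P Pκ a 0 0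
  Ω-C-step a = ≈-trans (Cayley-C.D-cong (move-ones (C ^P suc a)))
                 (≈-trans (Powers.cayley a) (*P-congʳ ⌜ cayley-factor a (0 ℕ.+ 0) ⌝ (≈-sym (move-ones (C ^P a)))))
    where
      move-ones : ∀ p → one *P one *P p ≈ p *P one
      move-ones = solve-∀ polyRing
      module Powers =
        Cayley-C.Powers one 0 0 (Ω-free iX₃ iY₂ iX₂ iY₃ one (refl ∷ []) (refl ∷ [])) (refl ∷ []) (refl ∷ [])

  peel : ∀ {B B′ : Poly → Poly → ℚ} → Bilinear B → Bilinear B′ → ∀ (Q P P′ : Poly) (D : Poly → Poly) (r : ℚ) (m : ℕ) →
         (∀ f g → B (Q *P f) g ≡ r * B′ f (D g)) → P ≈ Q *P P′ → D P ≈ ⌜ m ⌝ *P P′ →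
         B P P ≡ r * (ι m * B′ P′ P′)
  peel {B} {B′} bil bil′ Q P P′ D r m adjoint P≈QP′ DP≈mP′ = begin
      B P P                     ≡⟨ Bilinear.congˡ bil P P≈QP′ ⟩
      B (Q *P P′) P             ≡⟨ adjoint P′ P ⟩
      r * B′ P′ (D P)           ≡⟨ cong (r *_) (Bilinear.congʳ bil′ P′ DP≈mP′) ⟩
      r * B′ P′ (⌜ m ⌝ *P P′)   ≡⟨ cong (r *_) (Bilinear.cstʳ bil′ P′ (ι m) P′) ⟩
      r * (ι m * B′ P′ P′)      ∎
    where open ≡-Reasoning

  numer : ℕ → ℕ → ℕ → ℕ
  numer a b c = (a ℕ.+ b ℕ.+ c ℕ.+ 1) ! ℕ.* a ! ℕ.* b ! ℕ.* c !

  denom : ℕ → ℕ → ℕ → ℕ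
  denom a b c = (b ℕ.+ c) ! ℕ.* (a ℕ.+ c) ! ℕ.* (a ℕ.+ b) !

  R : ℕ → ℕ → ℕ → ℚ
  R a b c = (+ numer a b c / denom a b c) {{nz3 (b ℕ.+ c) (a ℕ.+ c) (a ℕ.+ b)}}

  ratio-step : ∀ k₁ k₂ m N D N′ D′ .{{_ : ℕ.NonZero D}} .{{_ : ℕ.NonZero D′}} →
    m ℕ.* N ℕ.* D′ ≡ N′ ℕ.* (suc k₁ ℕ.* (suc k₂ ℕ.* D)) →
    inv k₁ * inv k₂ * (ι m * (+ N / D)) ≡ + N′ / D′
  ratio-step k₁ k₂ m N D N′ D′ eq = begin
      inv k₁ * inv k₂ * (ι m * (+ N / D))
    ≡⟨ ℚP.*-assoc (inv k₁) (inv k₂) _ ⟩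
      inv k₁ * (inv k₂ * (ι m * (+ N / D)))
    ≡⟨ cong (λ x → inv k₁ * (inv k₂ * x)) (ι-/ m N D) ⟩
      inv k₁ * (inv k₂ * (+ (m ℕ.* N) / D))
    ≡⟨ cong (inv k₁ *_) (inv-/ k₂ (m ℕ.* N) D) ⟩
      inv k₁ * (+ (m ℕ.* N) / (suc k₂ ℕ.* D)) {{nz₂}}
    ≡⟨ inv-/ k₁ (m ℕ.* N) (suc k₂ ℕ.* D) {{nz₂}} ⟩
      (+ (m ℕ.* N) / (suc k₁ ℕ.* (suc k₂ ℕ.* D))) {{nz₁₂}}
    ≡⟨ /-cross (m ℕ.* N) (suc k₁ ℕ.* (suc k₂ ℕ.* D)) N′ D′ {{nz₁₂}} eq ⟩
      + N′ / D′ ∎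
    where
      open ≡-Reasoning
      nz₂ = ℕP.m*n≢0 (suc k₂) D
      nz₁₂ = ℕP.m*n≢0 (suc k₁) (suc k₂ ℕ.* D) {{_}} {{nz₂}}

  -- The three steps of the recursion for R, matching the three Cayley identities;
  -- after unfolding the factorials of successors they are polynomial identities.
  R-step-A : ∀ a b c → inv (b ℕ.+ c) * inv (a ℕ.+ c) * (ι (cayley-factor c (b ℕ.+ a)) * R a b c) ≡ R a b (suc c)
  R-step-A a b c = ratio-step (b ℕ.+ c) (a ℕ.+ c) (cayley-factor c (b ℕ.+ a)) (numer a b c) (denom a b c)
    (numer a b (suc c)) (denom a b (suc c))
    {{nz3 (b ℕ.+ c) (a ℕ.+ c) (a ℕ.+ b)}} {{nz3 (b ℕ.+ suc c) (a ℕ.+ suc c) (a ℕ.+ b)}} eq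
    where
      identity : ∀ a b c S A B C K₁ K₂ K₃ →
        suc c ℕ.* (suc (suc c) ℕ.+ (b ℕ.+ a)) ℕ.* (S ℕ.* A ℕ.* B ℕ.* C)
          ℕ.* (suc (b ℕ.+ c) ℕ.* K₁ ℕ.* (suc (a ℕ.+ c) ℕ.* K₂) ℕ.* K₃)
        ≡ suc (a ℕ.+ b ℕ.+ c ℕ.+ 1) ℕ.* S ℕ.* A ℕ.* B ℕ.* (suc c ℕ.* C)
          ℕ.* (suc (b ℕ.+ c) ℕ.* (suc (a ℕ.+ c) ℕ.* (K₁ ℕ.* K₂ ℕ.* K₃)))
      identity = ℕ-Solver.solve-∀
      shift : a ℕ.+ b ℕ.+ suc c ℕ.+ 1 ≡ suc (a ℕ.+ b ℕ.+ c ℕ.+ 1)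
      shift = cong (ℕ._+ 1) (ℕP.+-suc (a ℕ.+ b) c)
      eq : cayley-factor c (b ℕ.+ a) ℕ.* numer a b c ℕ.* denom a b (suc c)
           ≡ numer a b (suc c) ℕ.* (suc (b ℕ.+ c) ℕ.* (suc (a ℕ.+ c) ℕ.* denom a b c))
      eq rewrite shift | ℕP.+-suc b c | ℕP.+-suc a c =
        identity a b c ((a ℕ.+ b ℕ.+ c ℕ.+ 1) !) (a !) (b !) (c !) ((b ℕ.+ c) !) ((a ℕ.+ c) !) ((a ℕ.+ b) !)

  R-step-B : ∀ a b → inv (a ℕ.+ b) * inv (b ℕ.+ 0) * (ι (cayley-factor b (a ℕ.+ 0)) * R a b 0) ≡ R a (suc b) 0
  R-step-B a b = ratio-step (a ℕ.+ b) (b ℕ.+ 0) (cayley-factor b (a ℕ.+ 0)) (numer a b 0) (denom a b 0)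
    (numer a (suc b) 0) (denom a (suc b) 0)
    {{nz3 (b ℕ.+ 0) (a ℕ.+ 0) (a ℕ.+ b)}} {{nz3 (suc b ℕ.+ 0) (a ℕ.+ 0) (a ℕ.+ suc b)}} eq
    where
      identity : ∀ a b S A B K₁ K₂ K₃ →
        suc b ℕ.* (suc (suc b) ℕ.+ (a ℕ.+ 0)) ℕ.* (S ℕ.* A ℕ.* B ℕ.* 1)
          ℕ.* (suc (b ℕ.+ 0) ℕ.* K₁ ℕ.* K₂ ℕ.* (suc (a ℕ.+ b) ℕ.* K₃))
        ≡ suc (a ℕ.+ b ℕ.+ 0 ℕ.+ 1) ℕ.* S ℕ.* A ℕ.* (suc b ℕ.* B) ℕ.* 1
          ℕ.* (suc (a ℕ.+ b) ℕ.* (suc (b ℕ.+ 0) ℕ.* (K₁ ℕ.* K₂ ℕ.* K₃)))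
      identity = ℕ-Solver.solve-∀
      shift : a ℕ.+ suc b ℕ.+ 0 ℕ.+ 1 ≡ suc (a ℕ.+ b ℕ.+ 0 ℕ.+ 1)
      shift = cong (λ n → n ℕ.+ 0 ℕ.+ 1) (ℕP.+-suc a b)
      eq : cayley-factor b (a ℕ.+ 0) ℕ.* numer a b 0 ℕ.* denom a (suc b) 0
           ≡ numer a (suc b) 0 ℕ.* (suc (a ℕ.+ b) ℕ.* (suc (b ℕ.+ 0) ℕ.* denom a b 0))
      eq rewrite shift | ℕP.+-suc a b =
        identity a b ((a ℕ.+ b ℕ.+ 0 ℕ.+ 1) !) (a !) (b !) ((b ℕ.+ 0) !) ((a ℕ.+ 0) !) ((a ℕ.+ b) !)

  R-step-C : ∀ a → inv (a ℕ.+ 0) * inv (a ℕ.+ 0) * (ι (cayley-factor a (0 ℕ.+ 0)) * R a 0 0) ≡ R (suc a) 0 0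
  R-step-C a = ratio-step (a ℕ.+ 0) (a ℕ.+ 0) (cayley-factor a (0 ℕ.+ 0)) (numer a 0 0) (denom a 0 0)
    (numer (suc a) 0 0) (denom (suc a) 0 0) {{nz3 0 (a ℕ.+ 0) (a ℕ.+ 0)}} {{nz3 0 (suc a ℕ.+ 0) (suc a ℕ.+ 0)}}
    (identity a ((a ℕ.+ 0 ℕ.+ 0 ℕ.+ 1) !) (a !) ((a ℕ.+ 0) !))
    where
      identity : ∀ a S A K →
        suc a ℕ.* (suc (suc a) ℕ.+ 0) ℕ.* (S ℕ.* A ℕ.* 1 ℕ.* 1)
          ℕ.* (1 ℕ.* (suc (a ℕ.+ 0) ℕ.* K) ℕ.* (suc (a ℕ.+ 0) ℕ.* K))
        ≡ suc (a ℕ.+ 0 ℕ.+ 0 ℕ.+ 1) ℕ.* S ℕ.* (suc a ℕ.* A) ℕ.* 1 ℕ.* 1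
          ℕ.* (suc (a ℕ.+ 0) ℕ.* (suc (a ℕ.+ 0) ℕ.* (1 ℕ.* K ℕ.* K)))
      identity = ℕ-Solver.solve-∀

  norm-step-A : ∀ a b c → pairing (b ℕ.+ c) (a ℕ.+ c) (a ℕ.+ b) (Pκ a b c) (Pκ a b c) ≡ R a b c →
                pairing (b ℕ.+ suc c) (a ℕ.+ suc c) (a ℕ.+ b) (Pκ a b (suc c)) (Pκ a b (suc c)) ≡ R a b (suc c)
  norm-step-A a b c previous =
    subst₂ (λ κ₁ κ₂ → pairing κ₁ κ₂ κ₃ (Pκ a b (suc c)) (Pκ a b (suc c)) ≡ R a b (suc c))
           (sym (ℕP.+-suc b c)) (sym (ℕP.+-suc a c)) (begin
      pairing (suc k₁) (suc k₂) κ₃ (Pκ a b (suc c)) (Pκ a b (suc c))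
    ≡⟨ peel (pairing-bilinear (suc k₁) (suc k₂) κ₃) (pairing-bilinear k₁ k₂ κ₃) A (Pκ a b (suc c)) (Pκ a b c)
            (Ω iX₁ iY₂ iX₂ iY₁) (inv k₁ * inv k₂) m (adjoint-A k₁ k₂ κ₃) (reassociate (A ^P c) (B ^P b) (C ^P a))
            (Ω-A-step a b c) ⟩
      inv k₁ * inv k₂ * (ι m * pairing k₁ k₂ κ₃ (Pκ a b c) (Pκ a b c))
    ≡⟨ cong (λ x → inv k₁ * inv k₂ * (ι m * x)) previous ⟩
      inv k₁ * inv k₂ * (ι m * R a b c)
    ≡⟨ R-step-A a b c ⟩
      R a b (suc c) ∎)
    where
      open ≡-Reasoning
      k₁ = b ℕ.+ c
      k₂ = a ℕ.+ c
      κ₃ = a ℕ.+ b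
      m = cayley-factor c (b ℕ.+ a)
      reassociate : ∀ p q r → A *P p *P q *P r ≈ A *P (p *P q *P r)
      reassociate = solve-∀ polyRing

  norm-step-B : ∀ a b → pairing (b ℕ.+ 0) (a ℕ.+ 0) (a ℕ.+ b) (Pκ a b 0) (Pκ a b 0) ≡ R a b 0 →
                pairing (suc b ℕ.+ 0) (a ℕ.+ 0) (a ℕ.+ suc b) (Pκ a (suc b) 0) (Pκ a (suc b) 0) ≡ R a (suc b) 0
  norm-step-B a b previous =
    subst (λ κ₃ → pairing (suc k₁) κ₂ κ₃ (Pκ a (suc b) 0) (Pκ a (suc b) 0) ≡ R a (suc b) 0)
          (sym (ℕP.+-suc a b)) (begin
      pairing (suc k₁) κ₂ (suc k₃) (Pκ a (suc b) 0) (Pκ a (suc b) 0)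
    ≡⟨ peel (pairing-bilinear (suc k₁) κ₂ (suc k₃)) (pairing-bilinear k₁ κ₂ k₃) B (Pκ a (suc b) 0) (Pκ a b 0)
            (Ω iX₃ iY₁ iX₁ iY₃) (inv k₃ * inv k₁) m (adjoint-B k₁ κ₂ k₃) (reassociate (B ^P b) (C ^P a))
            (Ω-B-step a b) ⟩
      inv k₃ * inv k₁ * (ι m * pairing k₁ κ₂ k₃ (Pκ a b 0) (Pκ a b 0))
    ≡⟨ cong (λ x → inv k₃ * inv k₁ * (ι m * x)) previous ⟩
      inv k₃ * inv k₁ * (ι m * R a b 0)
    ≡⟨ R-step-B a b ⟩
      R a (suc b) 0 ∎)
    where
      open ≡-Reasoning
      k₁ = b ℕ.+ 0
      κ₂ = a ℕ.+ 0
      k₃ = a ℕ.+ b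
      m = cayley-factor b (a ℕ.+ 0)
      reassociate : ∀ p q → one *P (B *P p) *P q ≈ B *P (one *P p *P q)
      reassociate = solve-∀ polyRing

  norm-step-C : ∀ a → pairing 0 (a ℕ.+ 0) (a ℕ.+ 0) (Pκ a 0 0) (Pκ a 0 0) ≡ R a 0 0 →
                pairing 0 (suc a ℕ.+ 0) (suc a ℕ.+ 0) (Pκ (suc a) 0 0) (Pκ (suc a) 0 0) ≡ R (suc a) 0 0
  norm-step-C a previous = begin
      pairing 0 (suc k) (suc k) (Pκ (suc a) 0 0) (Pκ (suc a) 0 0)
    ≡⟨ peel (pairing-bilinear 0 (suc k) (suc k)) (pairing-bilinear 0 k k) C (Pκ (suc a) 0 0) (Pκ a 0 0)
            (Ω iX₃ iY₂ iX₂ iY₃) (inv k * inv k) m (adjoint-C 0 k k) (reassociate (C ^P a)) (Ω-C-step a) ⟩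
      inv k * inv k * (ι m * pairing 0 k k (Pκ a 0 0) (Pκ a 0 0))
    ≡⟨ cong (λ x → inv k * inv k * (ι m * x)) previous ⟩
      inv k * inv k * (ι m * R a 0 0)
    ≡⟨ R-step-C a ⟩
      R (suc a) 0 0 ∎
    where
      open ≡-Reasoning
      k = a ℕ.+ 0
      m = cayley-factor a (0 ℕ.+ 0)
      reassociate : ∀ p → one *P one *P (C *P p) ≈ C *P (one *P one *P p)
      reassociate = solve-∀ polyRing

  norm : ∀ a b c → pairing (b ℕ.+ c) (a ℕ.+ c) (a ℕ.+ b) (Pκ a b c) (Pκ a b c) ≡ R a b c
  norm zero zero zero = refl
  norm a b (suc c) = norm-step-A a b c (norm a b c)
  norm a (suc b) zero = norm-step-B a b (norm a b 0)
  norm (suc a) zero zero = norm-step-C a (norm a 0 0)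

  norm-at : ∀ a b c κ₁ κ₂ κ₃ S → b ℕ.+ c ≡ κ₁ → a ℕ.+ c ≡ κ₂ → a ℕ.+ b ≡ κ₃ → a ℕ.+ b ℕ.+ c ℕ.+ 1 ≡ S →
    pairing κ₁ κ₂ κ₃ (Pκ a b c) (Pκ a b c)
      ≡ (+ (S ! ℕ.* a ! ℕ.* b ! ℕ.* c !) / (κ₁ ! ℕ.* κ₂ ! ℕ.* κ₃ !)) {{nz3 κ₁ κ₂ κ₃}}
  norm-at a b c _ _ _ _ refl refl refl refl = norm a b c

  complement-sum : ∀ κ₁ κ₂ κ₃ s b c → κ₁ ℕ.+ (κ₂ ℕ.+ κ₃) ≡ 2 ℕ.* s → κ₂ ℕ.+ b ≡ s → κ₃ ℕ.+ c ≡ s → b ℕ.+ c ≡ κ₁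
  complement-sum κ₁ κ₂ κ₃ s b c total eb ec = ℕP.+-cancelˡ-≡ (κ₂ ℕ.+ κ₃) (b ℕ.+ c) κ₁ (begin
      (κ₂ ℕ.+ κ₃) ℕ.+ (b ℕ.+ c)   ≡⟨ interchange κ₂ κ₃ b c ⟩
      (κ₂ ℕ.+ b) ℕ.+ (κ₃ ℕ.+ c)   ≡⟨ cong₂ ℕ._+_ eb ec ⟩
      s ℕ.+ s                     ≡⟨ double s ⟩
      2 ℕ.* s                     ≡⟨ total ⟨
      κ₁ ℕ.+ (κ₂ ℕ.+ κ₃)          ≡⟨ ℕP.+-comm κ₁ (κ₂ ℕ.+ κ₃) ⟩
      (κ₂ ℕ.+ κ₃) ℕ.+ κ₁          ∎)
    where
      open ≡-Reasoning
      interchange : ∀ p q r t → (p ℕ.+ q) ℕ.+ (r ℕ.+ t) ≡ (p ℕ.+ r) ℕ.+ (q ℕ.+ t)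
      interchange = ℕ-Solver.solve-∀
      double : ∀ s → s ℕ.+ s ≡ 2 ℕ.* s
      double = ℕ-Solver.solve-∀

  duals : ∀ κ₁ κ₂ κ₃ s → κ₁ ℕ.+ κ₂ ℕ.+ κ₃ ≡ 2 ℕ.* s → κ₁ ℕ.≤ s → κ₂ ℕ.≤ s → κ₃ ℕ.≤ s →
          let a = s ℕ.∸ κ₁ ; b = s ℕ.∸ κ₂ ; c = s ℕ.∸ κ₃ in
          b ℕ.+ c ≡ κ₁ × a ℕ.+ c ≡ κ₂ × a ℕ.+ b ≡ κ₃ × a ℕ.+ b ℕ.+ c ℕ.+ 1 ≡ s ℕ.+ 1
  duals κ₁ κ₂ κ₃ s total κ₁≤s κ₂≤s κ₃≤s = b+c≡κ₁ , a+c≡κ₂ , a+b≡κ₃ , cong (ℕ._+ 1) (begin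
      a ℕ.+ b ℕ.+ c     ≡⟨ ℕP.+-assoc a b c ⟩
      a ℕ.+ (b ℕ.+ c)   ≡⟨ cong (a ℕ.+_) b+c≡κ₁ ⟩
      a ℕ.+ κ₁          ≡⟨ ℕP.+-comm a κ₁ ⟩
      κ₁ ℕ.+ a          ≡⟨ sa ⟩
      s                 ∎)
    where
      open ≡-Reasoning
      a = s ℕ.∸ κ₁
      b = s ℕ.∸ κ₂
      c = s ℕ.∸ κ₃
      sa = ℕP.m+[n∸m]≡n κ₁≤s
      sb = ℕP.m+[n∸m]≡n κ₂≤s
      sc = ℕP.m+[n∸m]≡n κ₃≤s
      rotate₂ : ∀ p q r → p ℕ.+ q ℕ.+ r ≡ q ℕ.+ (p ℕ.+ r)
      rotate₂ = ℕ-Solver.solve-∀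
      rotate₃ : ∀ p q r → p ℕ.+ q ℕ.+ r ≡ r ℕ.+ (p ℕ.+ q)
      rotate₃ = ℕ-Solver.solve-∀
      b+c≡κ₁ = complement-sum κ₁ κ₂ κ₃ s b c (trans (sym (ℕP.+-assoc κ₁ κ₂ κ₃)) total) sb sc
      a+c≡κ₂ = complement-sum κ₂ κ₁ κ₃ s a c (trans (sym (rotate₂ κ₁ κ₂ κ₃)) total) sa sc
      a+b≡κ₃ = complement-sum κ₃ κ₁ κ₂ s a b (trans (sym (rotate₃ κ₁ κ₂ κ₃)) total) sa sb

open import Data.Nat using (_+_; _*_; _∸_; _≤_)
open import Data.Rational using (_/_)

lemma4p11 : (κ₁ κ₂ κ₃ s : ℕ) → κ₁ + κ₂ + κ₃ ≡ 2 * s → κ₁ ≤ s → κ₂ ≤ s → κ₃ ≤ s →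
    pairing κ₁ κ₂ κ₃ (Pκ (s ∸ κ₁) (s ∸ κ₂) (s ∸ κ₃)) (Pκ (s ∸ κ₁) (s ∸ κ₂) (s ∸ κ₃))
      ≡ ((+ ((s + 1) ! * (s ∸ κ₁) ! * (s ∸ κ₂) ! * (s ∸ κ₃) !)) / (κ₁ ! * κ₂ ! * κ₃ !))
          {{nz3 κ₁ κ₂ κ₃}}
lemma4p11 κ₁ κ₂ κ₃ s total κ₁≤s κ₂≤s κ₃≤s =
  let (b+c≡κ₁ , a+c≡κ₂ , a+b≡κ₃ , a+b+c+1≡s+1) = duals κ₁ κ₂ κ₃ s total κ₁≤s κ₂≤s κ₃≤s
  in norm-at (s ∸ κ₁) (s ∸ κ₂) (s ∸ κ₃) κ₁ κ₂ κ₃ (s + 1) b+c≡κ₁ a+c≡κ₂ a+b≡κ₃ a+b+c+1≡s+1
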